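{- Let $M=M_n$ follow Stam's distribution and $A_n=\{m_n-n^{3/4}\le M\le m_n+n^{3/4}\}$. Then $\mathbb P(A_n^c)$ tends to $0$ faster than any rational function of $n$; that is, for every $k\ge0$, $n^k\,\mathbb P(A_n^c)\to0$ as $n\to\infty$.
   Context: For $n\ge1$, $M=M_n$ has $\mathbb P(M=m)=\frac{1}{eB_n}\frac{m^n}{m!}$ for $m\ge0$, $B_n$ the $n$-th Bell number; $m_n=\mathbb E(M)$. -}

module Defs where

open import Data.Nat as ℕ using (ℕ; zero; suc; _+_; _*_; _!; _≤_)
open import Data.Nat.Properties using (m≤n+m; ≤-trans; _!≢0)
open import Data.Integer using (+_)
open import Data.Rational using (ℚ; _/_; _-_; _<_; 0ℚ; 1ℚ)
open import Data.Rational using () renaming (_*_ to _*ℚ_; _+_ to _+ℚ_)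
open import Data.Rational.Properties using (_<?_)
open import Relation.Nullary using (does)
open import Data.Bool using (if_then_else_)

stirling : ℕ → ℕ → ℕ
stirling zero    zero    = 1
stirling zero    (suc k) = 0
stirling (suc n) zero    = 0
stirling (suc n) (suc k) = suc k * stirling n (suc k) + stirling n k

sumTo : ℕ → (ℕ → ℕ) → ℕ
sumTo zero    f = f 0
sumTo (suc n) f = sumTo n f + f (suc n)

bell : ℕ → ℕ
bell n = sumTo n (stirling n)

stirling-diag : ∀ n → 1 ≤ stirling n n
stirling-diag zero    = ℕ.s≤s ℕ.z≤n
stirling-diag (suc n) = ≤-trans (stirling-diag n) (m≤n+m (stirling n n) (suc n * stirling n (suc n)))

sumTo-last : ∀ n f → f n ≤ sumTo n f
sumTo-last zero    f = Data.Nat.Properties.≤-refl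
sumTo-last (suc n) f = m≤n+m (f (suc n)) (sumTo n f)

bell-pos : ∀ n → 1 ≤ bell n
bell-pos n = ≤-trans (stirling-diag n) (sumTo-last n (stirling n))

bell-nonZero : ∀ n → ℕ.NonZero (bell n)
bell-nonZero n = ℕ.>-nonZero (bell-pos n)

ℕtoℚ : ℕ → ℚ
ℕtoℚ m = + m / 1

_^ℚ_ : ℚ → ℕ → ℚ
p ^ℚ zero  = 1ℚ
p ^ℚ suc k = p *ℚ (p ^ℚ k)

-- the unnormalised Stam weight m^n / m!   (P(M_n = m) = weight n m / (e B_n))
weight : ℕ → ℕ → ℚ
weight n m = (+ (m ℕ.^ n) / (m !)) {{m !≢0}}

-- m_n = E(M_n) = B_{n+1} / B_n  (Dobinski)
mean : ℕ → ℚ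
mean n = (+ bell (suc n) / bell n) {{bell-nonZero n}}

-- m lies outside A_n = {m_n - n^{3/4} ≤ M ≤ m_n + n^{3/4}},
-- i.e. |m - m_n| > n^{3/4}, i.e. (m - m_n)^4 > n^3
outside : ℕ → ℕ → Set
outside n m = ℕtoℚ (n ℕ.^ 3) < (ℕtoℚ m - mean n) ^ℚ 4

-- Σ_{m < L, m ∉ A_n} m^n / m!   (partial sums of e B_n · P(A_n^c))
outsidePartial : ℕ → ℕ → ℚ
outsidePartial n zero    = 0ℚ
outsidePartial n (suc L) =
  if does (ℕtoℚ (n ℕ.^ 3) <? (ℕtoℚ L - mean n) ^ℚ 4)
  then outsidePartial n L +ℚ weight n L
  else outsidePartial n L

{-# OPTIONS --safe #-}
-- Write w(m) = mⁿ/m!, so that P(M = m) = w(m)/(e Bₙ).  The ratio w(m+1)/w(m) = (1+1/m)ⁿ/(m+1)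
-- decreases in m, so w is unimodal with a mode a ≤ 2n, and comparing consecutive ratios shows that
-- every step beyond distance h from a multiplies the weight by at most (2n+1)/(2n+1+h).  Hence each
-- m with |m − a| ≥ 2h has w(m) ≤ Bₙ ((2n+1)/(2n+1+h))ʰ, and beyond 4(2n+1) the terms (m+1) w(m) halve
-- at every step, so these far indices carry total weight at most Bₙ/Z, where by Bernoulli's inequality
-- Z can be any fixed power of n once h ≈ n^{3/4}.  The mean mₙ = Bₙ₊₁/Bₙ = Σ m w(m) / Σ w(m) (Dobinski's formula,
-- used in a finite form with explicit tail errors) therefore lies within 2h + 1 of a, so every m with
-- |m − mₙ| > n^{3/4} ≥ 4h + 1 is far from the mode.
module Submission where

open import Level using (0ℓ)
open import Relation.Binary.PropositionalEquality
open import Defs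
open import Data.Nat.Base as ℕ using (ℕ)

module Rationals where

  open import Data.Nat.Base as ℕ using (ℕ; zero; suc)
  import Data.Nat.Properties as ℕ
  import Data.Nat.Coprimality as Coprime
  open import Data.Integer.Base as ℤ using (+_)
  import Data.Integer.Properties as ℤ
  open import Data.Rational.Base
  open import Data.Rational.Properties
  import Data.Rational.Unnormalised.Base as ℚᵘ
  import Data.Rational.Unnormalised.Properties as ℚᵘ
  import Relation.Nullary.Decidable as Dec
  open import Relation.Nullary using (contradiction)
  open import Data.Product.Base using (∃-syntax; _,_)
  open import Data.Sum.Base using (inj₁; inj₂)
  open import Tactic.RingSolver using (solve-∀)
  import Tactic.RingSolver.Core.AlmostCommutativeRing as ACR
  open import Algebra.Bundles using (CommutativeMonoid)
  open import Algebra.Properties.CommutativeSemigroup (CommutativeMonoid.commutativeSemigroup *-1-commutativeMonoid) public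
    using (x∙yz≈xz∙y; xy∙z≈xz∙y; x∙yz≈y∙xz; xy∙z≈y∙xz; x∙yz≈yx∙z)

  ring : ACR.AlmostCommutativeRing 0ℓ 0ℓ
  ring = ACR.fromCommutativeRing +-*-commutativeRing λ x → Dec.dec⇒maybe (0ℚ ≟ x)

  x+y-x≡y : ∀ x y → x + y - x ≡ y
  x+y-x≡y = solve-∀ ring

  x+y-y≡x : ∀ x y → x + y - y ≡ x
  x+y-y≡x = solve-∀ ring

  two : ℚ
  two = ℕtoℚ 2

  x+x≡x*two : ∀ x → x + x ≡ x * two
  x+x≡x*two = solve-∀ ring

  ℕtoℚ≡mkℚ : ∀ a → ℕtoℚ a ≡ mkℚ (+ a) 0 (Coprime.sym (Coprime.1-coprimeTo a))
  ℕtoℚ≡mkℚ a = normalize-coprime (Coprime.sym (Coprime.1-coprimeTo a))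

  ℕtoℚ-+ : ∀ a b → ℕtoℚ (a ℕ.+ b) ≡ ℕtoℚ a + ℕtoℚ b
  ℕtoℚ-+ a b rewrite ℕtoℚ≡mkℚ a | ℕtoℚ≡mkℚ b =
    /-cong (trans (ℤ.pos-+ a b) (sym (cong₂ ℤ._+_ (ℤ.*-identityʳ (+ a)) (ℤ.*-identityʳ (+ b))))) refl

  ℕtoℚ-* : ∀ a b → ℕtoℚ (a ℕ.* b) ≡ ℕtoℚ a * ℕtoℚ b
  ℕtoℚ-* a b rewrite ℕtoℚ≡mkℚ a | ℕtoℚ≡mkℚ b = /-cong (ℤ.pos-* a b) refl

  ℕtoℚ-^ : ∀ a j → ℕtoℚ (a ℕ.^ j) ≡ ℕtoℚ a ^ℚ j
  ℕtoℚ-^ a zero    = refl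
  ℕtoℚ-^ a (suc j) = trans (ℕtoℚ-* a (a ℕ.^ j)) (cong (ℕtoℚ a *_) (ℕtoℚ-^ a j))

  ℕtoℚ-mono-≤ : ∀ {a b} → a ℕ.≤ b → ℕtoℚ a ≤ ℕtoℚ b
  ℕtoℚ-mono-≤ {a} {b} a≤b rewrite ℕtoℚ≡mkℚ a | ℕtoℚ≡mkℚ b =
    *≤* (subst₂ ℤ._≤_ (sym (ℤ.*-identityʳ (+ a))) (sym (ℤ.*-identityʳ (+ b))) (ℤ.+≤+ a≤b))

  ℕtoℚ-nonNeg : ∀ a → 0ℚ ≤ ℕtoℚ a
  ℕtoℚ-nonNeg a = ℕtoℚ-mono-≤ {0} {a} ℕ.z≤n

  ℕtoℚ-pos : ∀ a .{{_ : ℕ.NonZero a}} → 0ℚ < ℕtoℚ a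
  ℕtoℚ-pos (suc a) rewrite ℕtoℚ≡mkℚ (suc a) = *<* (ℤ.+<+ (ℕ.s≤s ℕ.z≤n))

  a/b*b≡a : ∀ a b .{{_ : ℕ.NonZero b}} → (+ a / b) * ℕtoℚ b ≡ ℕtoℚ a
  a/b*b≡a a b@(suc b-1) = toℚᵘ-injective (begin
    toℚᵘ (+ a / b * ℕtoℚ b)                  ≈⟨ toℚᵘ-homo-* (+ a / b) (ℕtoℚ b) ⟩
    toℚᵘ (+ a / b) ℚᵘ.* toℚᵘ (ℕtoℚ b)        ≈⟨ ℚᵘ.*-cong (toℚᵘ-fromℚᵘ (ℚᵘ.mkℚᵘ (+ a) b-1))
                                                           (toℚᵘ-fromℚᵘ (ℚᵘ.mkℚᵘ (+ b) 0)) ⟩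
    ℚᵘ.mkℚᵘ (+ a) b-1 ℚᵘ.* ℚᵘ.mkℚᵘ (+ b) 0   ≈⟨ ℚᵘ.*≡* a*b*1≡a*[b*1] ⟩
    ℚᵘ.mkℚᵘ (+ a) 0                          ≈⟨ ℚᵘ.≃-sym (toℚᵘ-fromℚᵘ (ℚᵘ.mkℚᵘ (+ a) 0)) ⟩
    toℚᵘ (ℕtoℚ a)                            ∎)
    where
    open ℚᵘ.≃-Reasoning
    a*b*1≡a*[b*1] : + a ℤ.* + b ℤ.* + 1 ≡ + a ℤ.* + (b ℕ.* 1)
    a*b*1≡a*[b*1] = trans (ℤ.*-identityʳ (+ a ℤ.* + b)) (cong (λ d → + a ℤ.* + d) (sym (ℕ.*-identityʳ b)))

  *-monoʳ-≤-nonNeg′ : ∀ {p q} r → 0ℚ ≤ r → p ≤ q → p * r ≤ q * r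
  *-monoʳ-≤-nonNeg′ r 0≤r = *-monoʳ-≤-nonNeg r {{nonNegative 0≤r}}

  *-monoˡ-≤-nonNeg′ : ∀ {p q} r → 0ℚ ≤ r → p ≤ q → r * p ≤ r * q
  *-monoˡ-≤-nonNeg′ r 0≤r = *-monoˡ-≤-nonNeg r {{nonNegative 0≤r}}

  *-mono-≤-nonNeg : ∀ {p q r s} → 0ℚ ≤ q → 0ℚ ≤ r → p ≤ q → r ≤ s → p * r ≤ q * s
  *-mono-≤-nonNeg {q = q} {r} 0≤q 0≤r p≤q r≤s =
    ≤-trans (*-monoʳ-≤-nonNeg′ r 0≤r p≤q) (*-monoˡ-≤-nonNeg′ q 0≤q r≤s)

  *-cancelʳ-≤-pos′ : ∀ {p q} r → 0ℚ < r → p * r ≤ q * r → p ≤ q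
  *-cancelʳ-≤-pos′ r 0<r = *-cancelʳ-≤-pos r {{positive 0<r}}

  *-cancelˡ-≤-pos′ : ∀ {p q} r → 0ℚ < r → r * p ≤ r * q → p ≤ q
  *-cancelˡ-≤-pos′ r 0<r = *-cancelˡ-≤-pos r {{positive 0<r}}

  *-cancelʳ-≡-pos : ∀ {p q} r → 0ℚ < r → p * r ≡ q * r → p ≡ q
  *-cancelʳ-≡-pos r 0<r eq =
    ≤-antisym (*-cancelʳ-≤-pos′ r 0<r (≤-reflexive eq)) (*-cancelʳ-≤-pos′ r 0<r (≤-reflexive (sym eq)))

  +-nonNeg : ∀ {p q} → 0ℚ ≤ p → 0ℚ ≤ q → 0ℚ ≤ p + q
  +-nonNeg = +-mono-≤

  *-nonNeg : ∀ {p q} → 0ℚ ≤ p → 0ℚ ≤ q → 0ℚ ≤ p * q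
  *-nonNeg {p} {q} 0≤p 0≤q = subst (_≤ p * q) (*-zeroˡ q) (*-monoʳ-≤-nonNeg′ q 0≤q 0≤p)

  *-pos : ∀ {p q} → 0ℚ < p → 0ℚ < q → 0ℚ < p * q
  *-pos {p} {q} 0<p 0<q = subst (_< p * q) (*-zeroˡ q) (*-monoˡ-<-pos q {{positive 0<q}} 0<p)

  ^ℚ-nonNeg : ∀ {p} j → 0ℚ ≤ p → 0ℚ ≤ p ^ℚ j
  ^ℚ-nonNeg zero    _   = ℕtoℚ-nonNeg 1
  ^ℚ-nonNeg (suc j) 0≤p = *-nonNeg 0≤p (^ℚ-nonNeg j 0≤p)

  ^ℚ-pos : ∀ {p} j → 0ℚ < p → 0ℚ < p ^ℚ j
  ^ℚ-pos zero    _   = ℕtoℚ-pos 1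
  ^ℚ-pos (suc j) 0<p = *-pos 0<p (^ℚ-pos j 0<p)

  1^ℚ≡1 : ∀ j → 1ℚ ^ℚ j ≡ 1ℚ
  1^ℚ≡1 zero    = refl
  1^ℚ≡1 (suc j) = trans (*-identityˡ (1ℚ ^ℚ j)) (1^ℚ≡1 j)

  ≤-+ʳ-nonNeg : ∀ {p q} r → 0ℚ ≤ r → p ≤ q → p ≤ q + r
  ≤-+ʳ-nonNeg {p} r 0≤r p≤q = subst (_≤ _) (+-identityʳ p) (+-mono-≤ p≤q 0≤r)

  ≤-+ˡ-nonNeg : ∀ {p q} r → 0ℚ ≤ r → p ≤ q → p ≤ r + q
  ≤-+ˡ-nonNeg {p} r 0≤r p≤q = subst (_≤ _) (+-identityˡ p) (+-mono-≤ 0≤r p≤q)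

  +-cancelʳ-≤ : ∀ {p q} r → p + r ≤ q + r → p ≤ q
  +-cancelʳ-≤ {p} {q} r p+r≤q+r = subst₂ _≤_ (x+y-y≡x p r) (x+y-y≡x q r) (+-monoˡ-≤ (- r) p+r≤q+r)

  ^ℚ-monoˡ-≤ : ∀ j {p q} → 0ℚ ≤ p → p ≤ q → p ^ℚ j ≤ q ^ℚ j
  ^ℚ-monoˡ-≤ zero    0≤p p≤q = ≤-refl
  ^ℚ-monoˡ-≤ (suc j) 0≤p p≤q =
    *-mono-≤-nonNeg (≤-trans 0≤p p≤q) (^ℚ-nonNeg j 0≤p) p≤q (^ℚ-monoˡ-≤ j 0≤p p≤q)

  [p-q]^4≤c^4 : ∀ {p q c} → p ≤ q + c → q ≤ p + c → (p - q) ^ℚ 4 ≤ c ^ℚ 4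
  [p-q]^4≤c^4 {p} {q} {c} p≤q+c q≤p+c with ≤-total 0ℚ (p - q)
  ... | inj₁ 0≤p-q = ^ℚ-monoˡ-≤ 4 0≤p-q (subst (p - q ≤_) (x+y-x≡y q c) (+-monoˡ-≤ (- q) p≤q+c))
  ... | inj₂ p-q≤0 = subst (_≤ c ^ℚ 4) (even-power (p - q)) (^ℚ-monoˡ-≤ 4 (neg-antimono-≤ p-q≤0) q-p≤c)
    where
    y-x≡-[x-y] : ∀ x y → y - x ≡ - (x - y)
    y-x≡-[x-y] = solve-∀ ring
    q-p≤c : - (p - q) ≤ c
    q-p≤c = subst₂ _≤_ (y-x≡-[x-y] p q) (x+y-x≡y p c) (+-monoˡ-≤ (- p) q≤p+c)
    even-power : ∀ x → (- x) * ((- x) * ((- x) * ((- x) * 1ℚ))) ≡ x * (x * (x * (x * 1ℚ)))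
    even-power = solve-∀ ring

  archimedean : ∀ ε → 0ℚ < ε → ∃[ q ] 1ℚ ≤ ε * ℕtoℚ (suc q)
  archimedean (mkℚ (+ 0) _ _)           (*<* 0<0) = contradiction 0<0 (ℤ.<-irrefl refl)
  archimedean ε@(mkℚ ℤ.+[1+ p ] d _) _ = d , subst (1ℚ ≤_) (sym ε*[1+d]≡1+p) (ℕtoℚ-mono-≤ {1} {suc p} (ℕ.s≤s ℕ.z≤n))
    where
    ε*[1+d]≡1+p : ε * ℕtoℚ (suc d) ≡ ℕtoℚ (suc p)
    ε*[1+d]≡1+p = trans (cong (_* ℕtoℚ (suc d)) (sym (↥p/↧p≡p ε))) (a/b*b≡a (suc p) (suc d))
  archimedean (mkℚ ℤ.-[1+ _ ] _ _)      (*<* -<0) = contradiction -<0 (ℤ.<-asym ℤ.-<+)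

  ≤-*-from-reciprocal : ∀ {x b ε q} → 0ℚ < q → 0ℚ ≤ b → 1ℚ ≤ ε * q → x * q ≤ b → x ≤ ε * b
  ≤-*-from-reciprocal {x} {b} {ε} {q} 0<q 0≤b 1≤εq xq≤b = *-cancelʳ-≤-pos′ q 0<q (begin
    x * q          ≤⟨ xq≤b ⟩
    b              ≡⟨ *-identityˡ b ⟨
    1ℚ * b         ≤⟨ *-monoʳ-≤-nonNeg′ b 0≤b 1≤εq ⟩
    ε * q * b      ≡⟨ xy∙z≈xz∙y ε q b ⟩
    ε * b * q      ∎)
    where open ≤-Reasoning

  2xz+t≤z : ∀ {x z t} → 0ℚ ≤ z → ℕtoℚ 4 * x ≤ 1ℚ → two * t ≤ z → two * x * z + t ≤ z
  2xz+t≤z {x} {z} {t} 0≤z 4x≤1 2t≤z = *-cancelˡ-≤-pos′ two (ℕtoℚ-pos 2) (begin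
    two * (two * x * z + t)      ≡⟨ distribute x z t ⟩
    ℕtoℚ 4 * x * z + two * t     ≤⟨ +-mono-≤ 4xz≤z 2t≤z ⟩
    z + z                        ≡⟨ trans (x+x≡x*two z) (*-comm z two) ⟩
    two * z                      ∎)
    where
    open ≤-Reasoning
    distribute : ∀ x z t → two * (two * x * z + t) ≡ ℕtoℚ 4 * x * z + two * t
    distribute = solve-∀ ring
    4xz≤z : ℕtoℚ 4 * x * z ≤ z
    4xz≤z = subst (ℕtoℚ 4 * x * z ≤_) (*-identityˡ z) (*-monoʳ-≤-nonNeg′ z 0≤z 4x≤1)

  ≤+1-by-perturbation : ∀ {a b e e′ W z t} → 0ℚ ≤ b → 1ℚ ≤ e → 0ℚ < z →
    e′ ≤ e + two * W → ℕtoℚ 4 * (b * W) ≤ 1ℚ → two * t ≤ z →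
    a * (e * z) ≤ b * (e′ * z) + t → a ≤ b + 1ℚ
  ≤+1-by-perturbation {a} {b} {e} {e′} {W} {z} {t} 0≤b 1≤e 0<z e′≤e+2W 4bW≤1 2t≤z a≤ =
    *-cancelʳ-≤-pos′ (e * z) (*-pos (<-≤-trans (ℕtoℚ-pos 1) 1≤e) 0<z) (begin
      a * (e * z)                           ≤⟨ a≤ ⟩
      b * (e′ * z) + t                      ≤⟨ +-monoˡ-≤ t (*-monoˡ-≤-nonNeg′ b 0≤b (*-monoʳ-≤-nonNeg′ z 0≤z e′≤e+2W)) ⟩
      b * ((e + two * W) * z) + t           ≡⟨ expand b e W z t ⟩
      b * (e * z) + (two * (b * W) * z + t) ≤⟨ +-monoʳ-≤ (b * (e * z)) (2xz+t≤z {b * W} {z} {t} 0≤z 4bW≤1 2t≤z) ⟩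
      b * (e * z) + z                       ≤⟨ +-monoʳ-≤ (b * (e * z)) z≤ez ⟩
      b * (e * z) + e * z                   ≡⟨ collect b (e * z) ⟩
      (b + 1ℚ) * (e * z)                    ∎)
    where
    open ≤-Reasoning
    0≤z : 0ℚ ≤ z
    0≤z = <⇒≤ 0<z
    z≤ez : z ≤ e * z
    z≤ez = subst (_≤ e * z) (*-identityˡ z) (*-monoʳ-≤-nonNeg′ z 0≤z 1≤e)
    expand : ∀ b e w z t → b * ((e + two * w) * z) + t ≡ b * (e * z) + (two * (b * w) * z + t)
    expand = solve-∀ ring
    collect : ∀ b x → b * x + x ≡ (b + 1ℚ) * x
    collect = solve-∀ ring

module FiniteSums where

  open import Data.Nat.Base as ℕ using (ℕ; zero; suc)
  import Data.Nat.Properties as ℕ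
  open import Data.Rational.Base
  open import Data.Rational.Properties
  open import Tactic.RingSolver using (solve-∀)
  open Rationals

  sumℚ : ℕ → (ℕ → ℚ) → ℚ
  sumℚ zero    f = 0ℚ
  sumℚ (suc L) f = sumℚ L f + f L

  sumℚ-cong : ∀ L {f g} → (∀ m → m ℕ.< L → f m ≡ g m) → sumℚ L f ≡ sumℚ L g
  sumℚ-cong zero    f≡g = refl
  sumℚ-cong (suc L) f≡g = cong₂ _+_ (sumℚ-cong L (λ m m<L → f≡g m (ℕ.m<n⇒m<1+n m<L))) (f≡g L ℕ.≤-refl)

  sumℚ-mono-≤ : ∀ L {f g} → (∀ m → m ℕ.< L → f m ≤ g m) → sumℚ L f ≤ sumℚ L g
  sumℚ-mono-≤ zero    f≤g = ≤-refl
  sumℚ-mono-≤ (suc L) f≤g = +-mono-≤ (sumℚ-mono-≤ L (λ m m<L → f≤g m (ℕ.m<n⇒m<1+n m<L))) (f≤g L ℕ.≤-refl)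

  sumℚ-nonNeg : ∀ L {f} → (∀ m → 0ℚ ≤ f m) → 0ℚ ≤ sumℚ L f
  sumℚ-nonNeg zero    0≤f = ≤-refl
  sumℚ-nonNeg (suc L) 0≤f = +-nonNeg (sumℚ-nonNeg L 0≤f) (0≤f L)

  sumℚ-+ : ∀ L f g → sumℚ L (λ m → f m + g m) ≡ sumℚ L f + sumℚ L g
  sumℚ-+ zero    f g = refl
  sumℚ-+ (suc L) f g rewrite sumℚ-+ L f g = interchange (sumℚ L f) (sumℚ L g) (f L) (g L)
    where
    interchange : ∀ a b c d → (a + b) + (c + d) ≡ (a + c) + (b + d)
    interchange = solve-∀ ring

  sumℚ-*ʳ : ∀ L f c → sumℚ L (λ m → f m * c) ≡ sumℚ L f * c
  sumℚ-*ʳ zero    f c = sym (*-zeroˡ c)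
  sumℚ-*ʳ (suc L) f c rewrite sumℚ-*ʳ L f c = sym (*-distribʳ-+ c (sumℚ L f) (f L))

  sumℚ-const : ∀ L c → sumℚ L (λ _ → c) ≡ ℕtoℚ L * c
  sumℚ-const zero    c = sym (*-zeroˡ c)
  sumℚ-const (suc L) c = begin
    sumℚ L (λ _ → c) + c   ≡⟨ cong (_+ c) (sumℚ-const L c) ⟩
    ℕtoℚ L * c + c         ≡⟨ +-comm (ℕtoℚ L * c) c ⟩
    c + ℕtoℚ L * c         ≡⟨ cong (_+ ℕtoℚ L * c) (*-identityˡ c) ⟨
    1ℚ * c + ℕtoℚ L * c    ≡⟨ *-distribʳ-+ c 1ℚ (ℕtoℚ L) ⟨
    (1ℚ + ℕtoℚ L) * c      ≡⟨ cong (_* c) (ℕtoℚ-+ 1 L) ⟨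
    ℕtoℚ (suc L) * c       ∎
    where open ≡-Reasoning

  sumℚ-suc : ∀ L f → sumℚ (suc L) f ≡ f 0 + sumℚ L (λ i → f (suc i))
  sumℚ-suc zero    f = trans (+-identityˡ (f 0)) (sym (+-identityʳ (f 0)))
  sumℚ-suc (suc L) f rewrite sumℚ-suc L f = +-assoc (f 0) _ _

  sumℚ-+-length : ∀ L j f → sumℚ (L ℕ.+ j) f ≡ sumℚ L f + sumℚ j (λ i → f (L ℕ.+ i))
  sumℚ-+-length L zero    f rewrite ℕ.+-identityʳ L = sym (+-identityʳ (sumℚ L f))
  sumℚ-+-length L (suc j) f rewrite ℕ.+-suc L j | sumℚ-+-length L j f = +-assoc (sumℚ L f) _ _

  sumℚ-mono-length : ∀ {L L′} f → (∀ m → 0ℚ ≤ f m) → L ℕ.≤ L′ → sumℚ L f ≤ sumℚ L′ f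
  sumℚ-mono-length {L} {L′} f 0≤f L≤L′ = begin
    sumℚ L f                                       ≤⟨ ≤-+ʳ-nonNeg _ (sumℚ-nonNeg (L′ ℕ.∸ L) (λ i → 0≤f (L ℕ.+ i))) ≤-refl ⟩
    sumℚ L f + sumℚ (L′ ℕ.∸ L) (λ i → f (L ℕ.+ i))  ≡⟨ sumℚ-+-length L (L′ ℕ.∸ L) f ⟨
    sumℚ (L ℕ.+ (L′ ℕ.∸ L)) f                      ≡⟨ cong (λ l → sumℚ l f) (ℕ.m+[n∸m]≡n L≤L′) ⟩
    sumℚ L′ f                                      ∎
    where open ≤-Reasoning

  ℕtoℚ-sumTo : ∀ p f → ℕtoℚ (sumTo p f) ≡ sumℚ (suc p) (λ k → ℕtoℚ (f k))
  ℕtoℚ-sumTo zero    f = sym (+-identityˡ (ℕtoℚ (f 0)))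
  ℕtoℚ-sumTo (suc p) f = trans (ℕtoℚ-+ (sumTo p f) (f (suc p))) (cong (_+ ℕtoℚ (f (suc p))) (ℕtoℚ-sumTo p f))

  geometric-bound : ∀ K (y : ℕ → ℚ) → 0ℚ ≤ K → (∀ i → y i * two ^ℚ i ≤ K) → ∀ j → sumℚ j y ≤ K + K
  geometric-bound K y 0≤K y≤K zero    = +-nonNeg 0≤K 0≤K
  geometric-bound K y 0≤K y≤K (suc j) = begin
    sumℚ (suc j) y                    ≡⟨ sumℚ-suc j y ⟩
    y 0 + sumℚ j (λ i → y (suc i))    ≤⟨ +-mono-≤ y₀≤K tail≤K ⟩
    K + K                             ∎
    where
    open ≤-Reasoning
    y₀≤K : y 0 ≤ K
    y₀≤K = subst (_≤ K) (*-identityʳ (y 0)) (y≤K 0)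
    doubled : sumℚ j (λ i → y (suc i) * two) ≤ K + K
    doubled = geometric-bound K (λ i → y (suc i) * two) 0≤K
                (λ i → subst (_≤ K) (sym (*-assoc (y (suc i)) two (two ^ℚ i))) (y≤K (suc i))) j
    tail≤K : sumℚ j (λ i → y (suc i)) ≤ K
    tail≤K = *-cancelʳ-≤-pos′ two (ℕtoℚ-pos 2)
      (subst₂ _≤_ (sumℚ-*ʳ j (λ i → y (suc i)) two) (x+x≡x*two K) doubled)

  geometric-tail-bound : ∀ T K (x : ℕ → ℚ) → 0ℚ ≤ K → (∀ m → 0ℚ ≤ x m) →
    (∀ m → m ℕ.< T → x m ≤ K) → (∀ i → x (T ℕ.+ i) * two ^ℚ i ≤ K) →
    ∀ L → sumℚ L x ≤ ℕtoℚ (T ℕ.+ 2) * K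
  geometric-tail-bound T K x 0≤K 0≤x head≤K tail≤K L = begin
    sumℚ L x                                   ≤⟨ sumℚ-mono-length x 0≤x (ℕ.m≤n+m L T) ⟩
    sumℚ (T ℕ.+ L) x                           ≡⟨ sumℚ-+-length T L x ⟩
    sumℚ T x + sumℚ L (λ i → x (T ℕ.+ i))      ≤⟨ +-mono-≤ (sumℚ-mono-≤ T head≤K) (geometric-bound K _ 0≤K tail≤K L) ⟩
    sumℚ T (λ _ → K) + (K + K)                 ≡⟨ cong₂ _+_ (sumℚ-const T K) (trans (x+x≡x*two K) (*-comm K two)) ⟩
    ℕtoℚ T * K + two * K                       ≡⟨ *-distribʳ-+ K (ℕtoℚ T) two ⟨
    (ℕtoℚ T + two) * K                         ≡⟨ cong (_* K) (ℕtoℚ-+ T 2) ⟨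
    ℕtoℚ (T ℕ.+ 2) * K                         ∎
    where open ≤-Reasoning

module RatioChains where

  open import Data.Nat.Base as ℕ using (ℕ; zero; suc)
  import Data.Nat.Properties as ℕ
  open import Data.Rational.Base
  open import Data.Rational.Properties
  open Rationals

  ratio-chain-up : ∀ (f : ℕ → ℚ) {c d} → 0ℚ ≤ c → 0ℚ ≤ d → ∀ m j →
    (∀ i → i ℕ.< j → f (m ℕ.+ i) * c ≤ f (suc (m ℕ.+ i)) * d) →
    f m * c ^ℚ j ≤ f (m ℕ.+ j) * d ^ℚ j
  ratio-chain-up f 0≤c 0≤d m zero    step rewrite ℕ.+-identityʳ m = ≤-refl
  ratio-chain-up f {c} {d} 0≤c 0≤d m (suc j) step rewrite ℕ.+-suc m j = begin
    f m * (c * c ^ℚ j)             ≡⟨ x∙yz≈xz∙y (f m) c (c ^ℚ j) ⟩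
    f m * c ^ℚ j * c               ≤⟨ *-monoʳ-≤-nonNeg′ c 0≤c (ratio-chain-up f 0≤c 0≤d m j (λ i i<j → step i (ℕ.m<n⇒m<1+n i<j))) ⟩
    f (m ℕ.+ j) * d ^ℚ j * c       ≡⟨ xy∙z≈xz∙y (f (m ℕ.+ j)) (d ^ℚ j) c ⟩
    f (m ℕ.+ j) * c * d ^ℚ j       ≤⟨ *-monoʳ-≤-nonNeg′ (d ^ℚ j) (^ℚ-nonNeg j 0≤d) (step j ℕ.≤-refl) ⟩
    f (suc (m ℕ.+ j)) * d * d ^ℚ j ≡⟨ *-assoc (f (suc (m ℕ.+ j))) d (d ^ℚ j) ⟩
    f (suc (m ℕ.+ j)) * (d * d ^ℚ j) ∎
    where open ≤-Reasoning

  ratio-chain-down : ∀ (f : ℕ → ℚ) {c d} → 0ℚ ≤ c → 0ℚ ≤ d → ∀ m j →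
    (∀ i → i ℕ.< j → f (suc (m ℕ.+ i)) * c ≤ f (m ℕ.+ i) * d) →
    f (m ℕ.+ j) * c ^ℚ j ≤ f m * d ^ℚ j
  ratio-chain-down f 0≤c 0≤d m zero    step rewrite ℕ.+-identityʳ m = ≤-refl
  ratio-chain-down f {c} {d} 0≤c 0≤d m (suc j) step rewrite ℕ.+-suc m j = begin
    f (suc (m ℕ.+ j)) * (c * c ^ℚ j) ≡⟨ *-assoc (f (suc (m ℕ.+ j))) c (c ^ℚ j) ⟨
    f (suc (m ℕ.+ j)) * c * c ^ℚ j   ≤⟨ *-monoʳ-≤-nonNeg′ (c ^ℚ j) (^ℚ-nonNeg j 0≤c) (step j ℕ.≤-refl) ⟩
    f (m ℕ.+ j) * d * c ^ℚ j         ≡⟨ xy∙z≈xz∙y (f (m ℕ.+ j)) d (c ^ℚ j) ⟩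
    f (m ℕ.+ j) * c ^ℚ j * d         ≤⟨ *-monoʳ-≤-nonNeg′ d 0≤d (ratio-chain-down f 0≤c 0≤d m j (λ i i<j → step i (ℕ.m<n⇒m<1+n i<j))) ⟩
    f m * d ^ℚ j * d                 ≡⟨ x∙yz≈xz∙y (f m) d (d ^ℚ j) ⟨
    f m * (d * d ^ℚ j)               ∎
    where open ≤-Reasoning

module Naturals where

  open import Data.Nat.Base
  open import Data.Nat.Properties
  open import Data.Nat.Tactic.RingSolver using (solve-∀)
  open import Data.Product.Base using (∃-syntax; _×_; _,_)
  open import Data.Empty using (⊥-elim)
  open import Relation.Nullary using (¬_; yes; no)
  open import Relation.Unary using (Decidable)
  open import Algebra.Properties.CommutativeSemigroup *-commutativeSemigroup using (x∙yz≈yx∙z; interchange)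

  crossing : ∀ {P : ℕ → Set} → Decidable P → ¬ P 0 → ∀ {b} → P b → ∃[ a ] (a < b × ¬ P a × P (suc a))
  crossing P? ¬P0 {zero}  P0 = ⊥-elim (¬P0 P0)
  crossing P? ¬P0 {suc b} P[1+b] with P? b
  ... | no ¬Pb = b , ≤-refl , ¬Pb , P[1+b]
  ... | yes Pb with crossing P? ¬P0 Pb
  ...   | a , a<b , ¬Pa , P[1+a] = a , m<n⇒m<1+n a<b , ¬Pa , P[1+a]

  ^-distribʳ-* : ∀ m n k → (m * n) ^ k ≡ m ^ k * n ^ k
  ^-distribʳ-* m n zero    = refl
  ^-distribʳ-* m n (suc k) rewrite ^-distribʳ-* m n k = interchange m n (m ^ k) (n ^ k)

  bernoulli : ∀ t x y → x ^ suc t + suc t * y * x ^ t ≤ (x + y) ^ suc t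
  bernoulli zero    x y = ≤-reflexive (x*1+1*y*1≡[x+y]*1 x y)
    where
    x*1+1*y*1≡[x+y]*1 : ∀ x y → x * 1 + 1 * y * 1 ≡ (x + y) * 1
    x*1+1*y*1≡[x+y]*1 = solve-∀
  bernoulli (suc t) x y = begin
    x * (x * p) + (2 + t) * y * (x * p)                          ≤⟨ m≤m+n _ ((1 + t) * y * y * p) ⟩
    x * (x * p) + (2 + t) * y * (x * p) + (1 + t) * y * y * p    ≡⟨ expand x y p t ⟩
    (x + y) * (x * p + (1 + t) * y * p)                          ≤⟨ *-monoʳ-≤ (x + y) (bernoulli t x y) ⟩
    (x + y) * (x + y) ^ suc t                                    ∎
    where
    open ≤-Reasoning
    p : ℕ
    p = x ^ t
    expand : ∀ x y p t → x * (x * p) + (2 + t) * y * (x * p) + (1 + t) * y * y * p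
                      ≡ (x + y) * (x * p + (1 + t) * y * p)
    expand = solve-∀

  bernoulli-power : ∀ t j X x → X * x ^ j ≤ (suc t * (suc t * j)) ^ j →
                    X * x ^ (suc t * j) ≤ (x + suc t * j) ^ (suc t * j)
  bernoulli-power t j X x X*xʲ≤[sh]ʲ = begin
    X * x ^ (j + t * j)             ≡⟨ cong (X *_) (^-distribˡ-+-* x j (t * j)) ⟩
    X * (x ^ j * x ^ (t * j))       ≡⟨ *-assoc X (x ^ j) _ ⟨
    X * x ^ j * x ^ (t * j)         ≤⟨ *-monoˡ-≤ (x ^ (t * j)) X*xʲ≤[sh]ʲ ⟩
    (s * h) ^ j * x ^ (t * j)       ≡⟨ cong ((s * h) ^ j *_) (^-*-assoc x t j) ⟨
    (s * h) ^ j * (x ^ t) ^ j       ≡⟨ ^-distribʳ-* (s * h) (x ^ t) j ⟨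
    (s * h * x ^ t) ^ j             ≤⟨ ^-monoˡ-≤ j (≤-trans (m≤n+m _ (x ^ s)) (bernoulli t x h)) ⟩
    ((x + h) ^ s) ^ j               ≡⟨ ^-*-assoc (x + h) s j ⟩
    (x + h) ^ (s * j)               ∎
    where
    open ≤-Reasoning
    s h : ℕ
    s = suc t
    h = s * j

  m<n⇒m³<n⁴ : ∀ {m n} → m < n → m ^ 3 < n ^ 4
  m<n⇒m³<n⁴ {m} {n} m<n = <-≤-trans (^-monoˡ-< 3 m<n) (^-monoʳ-≤ n {{>-nonZero (≤-<-trans z≤n m<n)}} (n≤1+n 3))

  a*n+b≤[a+b]*n : ∀ a b n .{{_ : NonZero n}} → a * n + b ≤ (a + b) * n
  a*n+b≤[a+b]*n a b n = ≤-trans (+-monoʳ-≤ (a * n) (m≤m*n b n)) (≤-reflexive (sym (*-distribʳ-+ n a b)))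

  suc-^-antitone : ∀ n {m m′} → m ≤ m′ → suc m′ ^ n * m ^ n ≤ suc m ^ n * m′ ^ n
  suc-^-antitone n {m} {m′} m≤m′ = begin
    suc m′ ^ n * m ^ n  ≡⟨ ^-distribʳ-* (suc m′) m n ⟨
    (suc m′ * m) ^ n    ≤⟨ ^-monoˡ-≤ n (+-monoˡ-≤ (m′ * m) m≤m′) ⟩
    (m′ + m′ * m) ^ n   ≡⟨ cong (λ z → (m′ + z) ^ n) (*-comm m′ m) ⟩
    (suc m * m′) ^ n    ≡⟨ ^-distribʳ-* (suc m) m′ n ⟩
    suc m ^ n * m′ ^ n  ∎
    where open ≤-Reasoning

  suc-^-ratio : ∀ j t → (j + t + 1) ^ j * t ≤ (j + t) ^ suc j
  suc-^-ratio zero    t rewrite *-identityʳ t | +-identityʳ t = ≤-refl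
  suc-^-ratio (suc j) t = *-cancelʳ-≤ _ _ (suc t) (begin
    X ^ suc j * t * suc t    ≡⟨ regroup X (X ^ j) t ⟩
    X ^ j * suc t * (X * t)  ≤⟨ *-monoˡ-≤ (X * t) IH ⟩
    Y ^ suc j * (X * t)      ≤⟨ *-monoʳ-≤ (Y ^ suc j) (subst (X * t ≤_) (Xt+j+1≡Y[1+t] j t) (m≤m+n (X * t) (j + 1))) ⟩
    Y ^ suc j * (Y * suc t)  ≡⟨ x∙yz≈yx∙z (Y ^ suc j) Y (suc t) ⟩
    Y ^ suc (suc j) * suc t  ∎)
    where
    open ≤-Reasoning
    X Y : ℕ
    X = suc j + t + 1
    Y = suc j + t
    IH : X ^ j * suc t ≤ Y ^ suc j
    IH = subst₂ (λ u v → u ^ j * suc t ≤ v ^ suc j) (cong (_+ 1) (+-suc j t)) (+-suc j t) (suc-^-ratio j (suc t))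
    regroup : ∀ x p t → x * p * t * (1 + t) ≡ p * (1 + t) * (x * t)
    regroup = solve-∀
    Xt+j+1≡Y[1+t] : ∀ j t → (1 + j + t + 1) * t + (j + 1) ≡ (1 + j + t) * (1 + t)
    Xt+j+1≡Y[1+t] = solve-∀

module StirlingExpansion where

  open import Data.Nat.Base
  open import Data.Nat.Properties
  open import Data.Nat.Combinatorics using ([n∸k]!k!∣n!)
  open import Data.Nat.Combinatorics.Base using (_P′_)
  open import Data.Nat.Combinatorics.Specification using (nP′k≡n!/[n∸k]!)
  open import Data.Nat.DivMod using (m/n*n≡m)
  open import Data.Nat.Divisibility using (∣-trans; m∣m*n)
  open import Relation.Nullary using (yes; no)
  open import Data.Nat.Tactic.RingSolver using (solve-∀)
  open import Algebra.Properties.CommutativeSemigroup *-commutativeSemigroup using (x∙yz≈y∙xz)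
  open import Algebra.Properties.CommutativeSemigroup +-commutativeSemigroup using ()
    renaming (interchange to +-interchange)

  k>n⇒nP′k≡0 : ∀ {n k} → n < k → n P′ k ≡ 0
  k>n⇒nP′k≡0 {n} {k} n<k = subst (λ k → n P′ k ≡ 0) (m+[n∸m]≡n n<k) (nP′[1+n+t]≡0 (k ∸ suc n))
    where
    nP′[1+n+t]≡0 : ∀ t → n P′ suc (n + t) ≡ 0
    nP′[1+n+t]≡0 zero    rewrite +-identityʳ n | n∸n≡0 n = refl
    nP′[1+n+t]≡0 (suc t) rewrite +-suc n t | nP′[1+n+t]≡0 t = *-zeroʳ (n ∸ suc (n + t))

  nP′k*[n∸k]!≡n! : ∀ {n k} → k ≤ n → (n P′ k) * (n ∸ k) ! ≡ n !
  nP′k*[n∸k]!≡n! {n} {k} k≤n = trans (cong (λ x → x * (n ∸ k) !) (nP′k≡n!/[n∸k]! {n} {k} k≤n))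
                                      (m/n*n≡m {{(n ∸ k) !≢0}} (∣-trans (m∣m*n (k !)) ([n∸k]!k!∣n! k≤n)))

  nP′k≤n! : ∀ n k → n P′ k ≤ n !
  nP′k≤n! n k with k ≤? n
  ... | yes k≤n = subst (n P′ k ≤_) (nP′k*[n∸k]!≡n! k≤n) (m≤m*n (n P′ k) ((n ∸ k) !) {{(n ∸ k) !≢0}})
  ... | no  k≰n rewrite k>n⇒nP′k≡0 (≰⇒> k≰n) = z≤n

  n*nP′k≡k*nP′k+nP′[1+k] : ∀ n k → n * (n P′ k) ≡ k * (n P′ k) + (n P′ suc k)
  n*nP′k≡k*nP′k+nP′[1+k] n k with k ≤? n
  ... | yes k≤n = trans (cong (_* (n P′ k)) (sym (m+[n∸m]≡n k≤n))) (*-distribʳ-+ (n P′ k) k (n ∸ k))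
  ... | no  k≰n rewrite k>n⇒nP′k≡0 (≰⇒> k≰n) | *-zeroʳ n | *-zeroʳ k | *-zeroʳ (n ∸ k) = refl

  sumTo-cong : ∀ p {f g} → (∀ k → f k ≡ g k) → sumTo p f ≡ sumTo p g
  sumTo-cong zero    f≡g = f≡g 0
  sumTo-cong (suc p) f≡g = cong₂ _+_ (sumTo-cong p f≡g) (f≡g (suc p))

  sumTo-mono-≤ : ∀ p {f g} → (∀ k → f k ≤ g k) → sumTo p f ≤ sumTo p g
  sumTo-mono-≤ zero    f≤g = f≤g 0
  sumTo-mono-≤ (suc p) f≤g = +-mono-≤ (sumTo-mono-≤ p f≤g) (f≤g (suc p))

  sumTo-+ : ∀ p f g → sumTo p (λ k → f k + g k) ≡ sumTo p f + sumTo p g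
  sumTo-+ zero    f g = refl
  sumTo-+ (suc p) f g rewrite sumTo-+ p f g = +-interchange (sumTo p f) (sumTo p g) (f (suc p)) (g (suc p))

  sumTo-*ˡ : ∀ p c f → sumTo p (λ k → c * f k) ≡ c * sumTo p f
  sumTo-*ˡ zero    c f = refl
  sumTo-*ˡ (suc p) c f rewrite sumTo-*ˡ p c f = sym (*-distribˡ-+ c (sumTo p f) (f (suc p)))

  sumTo-suc : ∀ p f → sumTo (suc p) f ≡ f 0 + sumTo p (λ k → f (suc k))
  sumTo-suc zero    f = refl
  sumTo-suc (suc p) f rewrite sumTo-suc p f = +-assoc (f 0) _ _

  sumTo-shift : ∀ p f → f 0 ≡ 0 → f (suc p) ≡ 0 → sumTo p f ≡ sumTo p (λ k → f (suc k))
  sumTo-shift p f f0≡0 f[1+p]≡0 = begin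
    sumTo p f                            ≡⟨ +-identityʳ (sumTo p f) ⟨
    sumTo p f + 0                        ≡⟨ cong (sumTo p f +_) f[1+p]≡0 ⟨
    sumTo (suc p) f                      ≡⟨ sumTo-suc p f ⟩
    f 0 + sumTo p (λ k → f (suc k))      ≡⟨ cong (_+ sumTo p (λ k → f (suc k))) f0≡0 ⟩
    sumTo p (λ k → f (suc k))            ∎
    where open ≡-Reasoning

  stirling-above : ∀ {p k} → p < k → stirling p k ≡ 0
  stirling-above {zero}  {suc k} _ = refl
  stirling-above {suc p} {suc k} (s≤s p<k)
    rewrite stirling-above (m<n⇒m<1+n p<k) | stirling-above p<k = trans (+-identityʳ _) (*-zeroʳ (suc k))

  ^≡sumTo-stirling*P′ : ∀ p m → m ^ p ≡ sumTo p (λ k → stirling p k * (m P′ k))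
  ^≡sumTo-stirling*P′ zero    m = refl
  ^≡sumTo-stirling*P′ (suc p) m = begin
    m * m ^ p                                                    ≡⟨ cong (m *_) (^≡sumTo-stirling*P′ p m) ⟩
    m * sumTo p (λ k → S k * P k)                                ≡⟨ sumTo-*ˡ p m _ ⟨
    sumTo p (λ k → m * (S k * P k))                              ≡⟨ sumTo-cong p split ⟩
    sumTo p (λ k → g k + S k * P (suc k))                        ≡⟨ sumTo-+ p g _ ⟩
    sumTo p g + sumTo p (λ k → S k * P (suc k))
      ≡⟨ cong (_+ sumTo p (λ k → S k * P (suc k))) (sumTo-shift p g refl g[1+p]≡0) ⟩
    sumTo p (λ k → g (suc k)) + sumTo p (λ k → S k * P (suc k))  ≡⟨ sumTo-+ p _ _ ⟨
    sumTo p (λ k → g (suc k) + S k * P (suc k))                  ≡⟨ sumTo-cong p recurrence ⟩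
    sumTo p (λ k → stirling (suc p) (suc k) * P (suc k))         ≡⟨ sumTo-suc p (λ k → stirling (suc p) k * P k) ⟨
    sumTo (suc p) (λ k → stirling (suc p) k * P k)               ∎
    where
    open ≡-Reasoning
    S P : ℕ → ℕ
    S = stirling p
    P = m P′_
    g : ℕ → ℕ
    g k = k * S k * P k
    g[1+p]≡0 : g (suc p) ≡ 0
    g[1+p]≡0 rewrite stirling-above {p} {suc p} ≤-refl | *-zeroʳ p = refl
    distribute : ∀ s k f f′ → s * (k * f + f′) ≡ k * s * f + s * f′
    distribute = solve-∀
    split : ∀ k → m * (S k * P k) ≡ g k + S k * P (suc k)
    split k = begin
      m * (S k * P k)                ≡⟨ x∙yz≈y∙xz m (S k) (P k) ⟩
      S k * (m * P k)                ≡⟨ cong (S k *_) (n*nP′k≡k*nP′k+nP′[1+k] m k) ⟩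
      S k * (k * P k + P (suc k))    ≡⟨ distribute (S k) k (P k) (P (suc k)) ⟩
      g k + S k * P (suc k)          ∎
    recurrence : ∀ k → g (suc k) + S k * P (suc k) ≡ stirling (suc p) (suc k) * P (suc k)
    recurrence k = sym (*-distribʳ-+ (P (suc k)) (suc k * S (suc k)) (S k))

  ^≤bell*! : ∀ n m → m ^ n ≤ bell n * m !
  ^≤bell*! n m = begin
    m ^ n                                    ≡⟨ ^≡sumTo-stirling*P′ n m ⟩
    sumTo n (λ k → stirling n k * (m P′ k))    ≤⟨ sumTo-mono-≤ n (λ k → *-monoʳ-≤ (stirling n k) (nP′k≤n! m k)) ⟩
    sumTo n (λ k → stirling n k * m !)       ≡⟨ sumTo-cong n (λ k → *-comm (stirling n k) (m !)) ⟩
    sumTo n (λ k → m ! * stirling n k)       ≡⟨ sumTo-*ˡ n (m !) (stirling n) ⟩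
    m ! * bell n                             ≡⟨ *-comm (m !) (bell n) ⟩
    bell n * m !                             ∎
    where open ≤-Reasoning

module Weights where

  open import Data.Nat.Base as ℕ using (ℕ; suc; _!)
  import Data.Nat.Properties as ℕ
  open import Data.Rational.Base
  open import Data.Rational.Properties
  open Rationals
  open StirlingExpansion using (^≤bell*!)

  ℕtoℚ-!-pos : ∀ m → 0ℚ < ℕtoℚ (m !)
  ℕtoℚ-!-pos m = ℕtoℚ-pos (m !) {{m ℕ.!≢0}}

  ℕtoℚ-bell-pos : ∀ n → 0ℚ < ℕtoℚ (bell n)
  ℕtoℚ-bell-pos n = ℕtoℚ-pos (bell n) {{bell-nonZero n}}

  weight-nonNeg : ∀ n m → 0ℚ ≤ weight n m
  weight-nonNeg n m = nonNegative⁻¹ _ {{normalize-nonNeg (m ℕ.^ n) (m !) {{m ℕ.!≢0}}}}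

  mean-nonNeg : ∀ n → 0ℚ ≤ mean n
  mean-nonNeg n = nonNegative⁻¹ _ {{normalize-nonNeg (bell (suc n)) (bell n) {{bell-nonZero n}}}}

  weight*! : ∀ n m → weight n m * ℕtoℚ (m !) ≡ ℕtoℚ (m ℕ.^ n)
  weight*! n m = a/b*b≡a (m ℕ.^ n) (m !) {{m ℕ.!≢0}}

  mean*bell : ∀ n → mean n * ℕtoℚ (bell n) ≡ ℕtoℚ (bell (suc n))
  mean*bell n = a/b*b≡a (bell (suc n)) (bell n) {{bell-nonZero n}}

  weight-suc*suc : ∀ n m → weight n (suc m) * ℕtoℚ (suc m) * ℕtoℚ (m !) ≡ ℕtoℚ (suc m ℕ.^ n)
  weight-suc*suc n m = begin
    weight n (suc m) * ℕtoℚ (suc m) * ℕtoℚ (m !)   ≡⟨ *-assoc (weight n (suc m)) _ _ ⟩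
    weight n (suc m) * (ℕtoℚ (suc m) * ℕtoℚ (m !)) ≡⟨ cong (weight n (suc m) *_) (ℕtoℚ-* (suc m) (m !)) ⟨
    weight n (suc m) * ℕtoℚ (suc m !)              ≡⟨ weight*! n (suc m) ⟩
    ℕtoℚ (suc m ℕ.^ n)                             ∎
    where open ≡-Reasoning

  weight-suc-exponent : ∀ n m → weight (suc n) m ≡ ℕtoℚ m * weight n m
  weight-suc-exponent n m = *-cancelʳ-≡-pos (ℕtoℚ (m !)) (ℕtoℚ-!-pos m) (begin
    weight (suc n) m * ℕtoℚ (m !)   ≡⟨ weight*! (suc n) m ⟩
    ℕtoℚ (m ℕ.* m ℕ.^ n)            ≡⟨ ℕtoℚ-* m (m ℕ.^ n) ⟩
    ℕtoℚ m * ℕtoℚ (m ℕ.^ n)         ≡⟨ cong (ℕtoℚ m *_) (weight*! n m) ⟨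
    ℕtoℚ m * (weight n m * ℕtoℚ (m !)) ≡⟨ *-assoc (ℕtoℚ m) (weight n m) _ ⟨
    ℕtoℚ m * weight n m * ℕtoℚ (m !) ∎)
    where open ≡-Reasoning

  weight≤bell : ∀ n m → weight n m ≤ ℕtoℚ (bell n)
  weight≤bell n m = *-cancelʳ-≤-pos′ (ℕtoℚ (m !)) (ℕtoℚ-!-pos m) (begin
    weight n m * ℕtoℚ (m !)       ≡⟨ weight*! n m ⟩
    ℕtoℚ (m ℕ.^ n)                ≤⟨ ℕtoℚ-mono-≤ (^≤bell*! n m) ⟩
    ℕtoℚ (bell n ℕ.* m !)         ≡⟨ ℕtoℚ-* (bell n) (m !) ⟩
    ℕtoℚ (bell n) * ℕtoℚ (m !)    ∎)
    where open ≤-Reasoning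

module Dobinski where

  open import Data.Nat.Base as ℕ using (ℕ; zero; suc; _!; _∸_)
  import Data.Nat.Properties as ℕ
  open import Data.Nat.Combinatorics.Base using (_P′_)
  import Data.Integer.Base as ℤ
  open import Data.Rational.Base
  open import Data.Rational.Properties
  open import Relation.Nullary using (yes; no)
  open Rationals
  open FiniteSums
  open StirlingExpansion using (k>n⇒nP′k≡0; nP′k*[n∸k]!≡n!; ^≡sumTo-stirling*P′)
  open Weights

  expSum : ℕ → ℚ
  expSum L = sumℚ L (weight 0)

  expSum-mono-≤ : ∀ {L L′} → L ℕ.≤ L′ → expSum L ≤ expSum L′
  expSum-mono-≤ = sumℚ-mono-length (weight 0) (weight-nonNeg 0)

  fallingWeight : ℕ → ℕ → ℚ
  fallingWeight L k = (ℤ.+ (L P′ k) / L !) {{L ℕ.!≢0}}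

  fallingWeight*! : ∀ L k → fallingWeight L k * ℕtoℚ (L !) ≡ ℕtoℚ (L P′ k)
  fallingWeight*! L k = a/b*b≡a (L P′ k) (L !) {{L ℕ.!≢0}}

  fallingWeight≡weight0 : ∀ {L k} → k ℕ.≤ L → fallingWeight L k ≡ weight 0 (L ∸ k)
  fallingWeight≡weight0 {L} {k} k≤L = *-cancelʳ-≡-pos (ℕtoℚ (L !)) (ℕtoℚ-!-pos L) (begin
    fallingWeight L k * ℕtoℚ (L !)                         ≡⟨ fallingWeight*! L k ⟩
    ℕtoℚ (L P′ k)                                          ≡⟨ *-identityʳ (ℕtoℚ (L P′ k)) ⟨
    ℕtoℚ (L P′ k) * 1ℚ                                     ≡⟨ cong (ℕtoℚ (L P′ k) *_) (weight*! 0 (L ∸ k)) ⟨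
    ℕtoℚ (L P′ k) * (weight 0 (L ∸ k) * ℕtoℚ ((L ∸ k) !))  ≡⟨ x∙yz≈y∙xz (ℕtoℚ (L P′ k)) (weight 0 (L ∸ k)) _ ⟩
    weight 0 (L ∸ k) * (ℕtoℚ (L P′ k) * ℕtoℚ ((L ∸ k) !))  ≡⟨ cong (weight 0 (L ∸ k) *_) (ℕtoℚ-* (L P′ k) ((L ∸ k) !)) ⟨
    weight 0 (L ∸ k) * ℕtoℚ ((L P′ k) ℕ.* (L ∸ k) !)       ≡⟨ cong (λ x → weight 0 (L ∸ k) * ℕtoℚ x) (nP′k*[n∸k]!≡n! k≤L) ⟩
    weight 0 (L ∸ k) * ℕtoℚ (L !)                          ∎)
    where open ≡-Reasoning

  fallingWeight≡0 : ∀ {L k} → L ℕ.< k → fallingWeight L k ≡ 0ℚ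
  fallingWeight≡0 {L} {k} L<k = *-cancelʳ-≡-pos (ℕtoℚ (L !)) (ℕtoℚ-!-pos L)
    (trans (fallingWeight*! L k) (trans (cong ℕtoℚ (k>n⇒nP′k≡0 L<k)) (sym (*-zeroˡ (ℕtoℚ (L !))))))

  expSum-suc-∸ : ∀ L k → expSum (suc L ∸ k) ≡ expSum (L ∸ k) + fallingWeight L k
  expSum-suc-∸ L k with k ℕ.≤? L
  ... | yes k≤L = begin
    expSum (suc L ∸ k)                   ≡⟨ cong expSum (ℕ.+-∸-assoc 1 k≤L) ⟩
    expSum (L ∸ k) + weight 0 (L ∸ k)    ≡⟨ cong (expSum (L ∸ k) +_) (fallingWeight≡weight0 k≤L) ⟨
    expSum (L ∸ k) + fallingWeight L k   ∎
    where open ≡-Reasoning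
  ... | no k≰L = begin
    expSum (suc L ∸ k)                   ≡⟨ cong expSum (ℕ.m≤n⇒m∸n≡0 (ℕ.≰⇒> k≰L)) ⟩
    0ℚ                                   ≡⟨ fallingWeight≡0 (ℕ.≰⇒> k≰L) ⟨
    fallingWeight L k                    ≡⟨ +-identityˡ (fallingWeight L k) ⟨
    0ℚ + fallingWeight L k               ≡⟨ cong (λ l → expSum l + fallingWeight L k) (ℕ.m≤n⇒m∸n≡0 (ℕ.<⇒≤ (ℕ.≰⇒> k≰L))) ⟨
    expSum (L ∸ k) + fallingWeight L k   ∎
    where open ≡-Reasoning

  weight≡sumℚ-stirling : ∀ p L → weight p L ≡ sumℚ (suc p) (λ k → ℕtoℚ (stirling p k) * fallingWeight L k)
  weight≡sumℚ-stirling p L = *-cancelʳ-≡-pos (ℕtoℚ (L !)) (ℕtoℚ-!-pos L) (begin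
    weight p L * ℕtoℚ (L !)                                                ≡⟨ weight*! p L ⟩
    ℕtoℚ (L ℕ.^ p)                                                         ≡⟨ cong ℕtoℚ (^≡sumTo-stirling*P′ p L) ⟩
    ℕtoℚ (sumTo p (λ k → stirling p k ℕ.* (L P′ k)))                       ≡⟨ ℕtoℚ-sumTo p _ ⟩
    sumℚ (suc p) (λ k → ℕtoℚ (stirling p k ℕ.* (L P′ k)))                  ≡⟨ sumℚ-cong (suc p) (λ k _ → term k) ⟩
    sumℚ (suc p) (λ k → ℕtoℚ (stirling p k) * fallingWeight L k * ℕtoℚ (L !)) ≡⟨ sumℚ-*ʳ (suc p) _ (ℕtoℚ (L !)) ⟩
    sumℚ (suc p) (λ k → ℕtoℚ (stirling p k) * fallingWeight L k) * ℕtoℚ (L !) ∎)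
    where
    open ≡-Reasoning
    term : ∀ k → ℕtoℚ (stirling p k ℕ.* (L P′ k)) ≡ ℕtoℚ (stirling p k) * fallingWeight L k * ℕtoℚ (L !)
    term k = begin
      ℕtoℚ (stirling p k ℕ.* (L P′ k))                       ≡⟨ ℕtoℚ-* (stirling p k) (L P′ k) ⟩
      ℕtoℚ (stirling p k) * ℕtoℚ (L P′ k)                    ≡⟨ cong (ℕtoℚ (stirling p k) *_) (fallingWeight*! L k) ⟨
      ℕtoℚ (stirling p k) * (fallingWeight L k * ℕtoℚ (L !)) ≡⟨ *-assoc (ℕtoℚ (stirling p k)) (fallingWeight L k) _ ⟨
      ℕtoℚ (stirling p k) * fallingWeight L k * ℕtoℚ (L !)   ∎

  dobinski : ∀ p L → sumℚ L (weight p) ≡ sumℚ (suc p) (λ k → ℕtoℚ (stirling p k) * expSum (L ∸ k))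
  dobinski p zero    = sym (begin
    sumℚ (suc p) (λ k → ℕtoℚ (stirling p k) * expSum (0 ∸ k)) ≡⟨ sumℚ-cong (suc p) (λ k _ → vanish k) ⟩
    sumℚ (suc p) (λ _ → 0ℚ)                                   ≡⟨ sumℚ-const (suc p) 0ℚ ⟩
    ℕtoℚ (suc p) * 0ℚ                                         ≡⟨ *-zeroʳ (ℕtoℚ (suc p)) ⟩
    0ℚ                                                        ∎)
    where
    open ≡-Reasoning
    vanish : ∀ k → ℕtoℚ (stirling p k) * expSum (0 ∸ k) ≡ 0ℚ
    vanish k = trans (cong (λ l → ℕtoℚ (stirling p k) * expSum l) (ℕ.0∸n≡0 k)) (*-zeroʳ (ℕtoℚ (stirling p k)))
  dobinski p (suc L) = begin
    sumℚ L (weight p) + weight p L                                ≡⟨ cong₂ _+_ (dobinski p L) (weight≡sumℚ-stirling p L) ⟩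
    sumℚ (suc p) (λ k → S k * expSum (L ∸ k)) + sumℚ (suc p) (λ k → S k * fallingWeight L k)
                                                                  ≡⟨ sumℚ-+ (suc p) _ _ ⟨
    sumℚ (suc p) (λ k → S k * expSum (L ∸ k) + S k * fallingWeight L k)
                                                                  ≡⟨ sumℚ-cong (suc p) (λ k _ → collect k) ⟩
    sumℚ (suc p) (λ k → S k * expSum (suc L ∸ k))                 ∎
    where
    open ≡-Reasoning
    S : ℕ → ℚ
    S k = ℕtoℚ (stirling p k)
    collect : ∀ k → S k * expSum (L ∸ k) + S k * fallingWeight L k ≡ S k * expSum (suc L ∸ k)
    collect k = trans (sym (*-distribˡ-+ (S k) (expSum (L ∸ k)) (fallingWeight L k))) (cong (S k *_) (sym (expSum-suc-∸ L k)))

  dobinski-upper : ∀ p L → sumℚ L (weight p) ≤ ℕtoℚ (bell p) * expSum L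
  dobinski-upper p L = begin
    sumℚ L (weight p)                                          ≡⟨ dobinski p L ⟩
    sumℚ (suc p) (λ k → ℕtoℚ (stirling p k) * expSum (L ∸ k))
      ≤⟨ sumℚ-mono-≤ (suc p) (λ k _ → *-monoˡ-≤-nonNeg′ _ (ℕtoℚ-nonNeg (stirling p k)) (expSum-mono-≤ (ℕ.m∸n≤m L k))) ⟩
    sumℚ (suc p) (λ k → ℕtoℚ (stirling p k) * expSum L)        ≡⟨ sumℚ-*ʳ (suc p) _ (expSum L) ⟩
    sumℚ (suc p) (λ k → ℕtoℚ (stirling p k)) * expSum L        ≡⟨ cong (_* expSum L) (ℕtoℚ-sumTo p (stirling p)) ⟨
    ℕtoℚ (bell p) * expSum L                                   ∎
    where open ≤-Reasoning

  dobinski-lower : ∀ p L → ℕtoℚ (bell p) * expSum (L ∸ p) ≤ sumℚ L (weight p)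
  dobinski-lower p L = begin
    ℕtoℚ (bell p) * expSum (L ∸ p)                             ≡⟨ cong (_* expSum (L ∸ p)) (ℕtoℚ-sumTo p (stirling p)) ⟩
    sumℚ (suc p) (λ k → ℕtoℚ (stirling p k)) * expSum (L ∸ p)  ≡⟨ sumℚ-*ʳ (suc p) _ (expSum (L ∸ p)) ⟨
    sumℚ (suc p) (λ k → ℕtoℚ (stirling p k) * expSum (L ∸ p))
      ≤⟨ sumℚ-mono-≤ (suc p) (λ k k≤p → *-monoˡ-≤-nonNeg′ _ (ℕtoℚ-nonNeg (stirling p k)) (expSum-mono-≤ (ℕ.∸-monoʳ-≤ L (ℕ.≤-pred k≤p)))) ⟩
    sumℚ (suc p) (λ k → ℕtoℚ (stirling p k) * expSum (L ∸ k))  ≡⟨ dobinski p L ⟨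
    sumℚ L (weight p)                                          ∎
    where open ≤-Reasoning

  weight0-suc : ∀ M → weight 0 (suc M) * ℕtoℚ (suc M) ≡ weight 0 M
  weight0-suc M = *-cancelʳ-≡-pos (ℕtoℚ (M !)) (ℕtoℚ-!-pos M) (trans (weight-suc*suc 0 M) (sym (weight*! 0 M)))

  weight0*≤1 : ∀ N → weight 0 N * ℕtoℚ N ≤ 1ℚ
  weight0*≤1 N = ≤-trans (*-monoˡ-≤-nonNeg′ (weight 0 N) (weight-nonNeg 0 N) (ℕtoℚ-mono-≤ (n≤n! N))) (≤-reflexive (weight*! 0 N))
    where
    n≤n! : ∀ n → n ℕ.≤ n !
    n≤n! zero    = ℕ.z≤n
    n≤n! (suc n) = ℕ.m≤m*n (suc n) (n !) {{n ℕ.!≢0}}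

  expSum-tail : ∀ {N L} → 1 ℕ.≤ N → N ℕ.≤ L → expSum L ≤ expSum N + two * weight 0 N
  expSum-tail {N} {L} 1≤N N≤L = begin
    expSum L                          ≤⟨ ≤-+ʳ-nonNeg _ (*-nonNeg (ℕtoℚ-nonNeg 2) (weight-nonNeg 0 L)) ≤-refl ⟩
    Φ L                               ≡⟨ cong Φ (ℕ.m+[n∸m]≡n N≤L) ⟨
    Φ (N ℕ.+ (L ∸ N))                 ≤⟨ Φ-antitone (L ∸ N) ⟩
    Φ N                               ∎
    where
    open ≤-Reasoning
    Φ : ℕ → ℚ
    Φ M = expSum M + two * weight 0 M
    Φ-step : ∀ M → 1 ℕ.≤ M → Φ (suc M) ≤ Φ M
    Φ-step M 1≤M = begin
      expSum M + weight 0 M + two * weight 0 (suc M)  ≤⟨ +-monoʳ-≤ (expSum M + weight 0 M) halve ⟩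
      expSum M + weight 0 M + weight 0 M              ≡⟨ +-assoc (expSum M) (weight 0 M) (weight 0 M) ⟩
      expSum M + (weight 0 M + weight 0 M)            ≡⟨ cong (expSum M +_) (trans (x+x≡x*two (weight 0 M)) (*-comm (weight 0 M) two)) ⟩
      Φ M                                             ∎
      where
      halve : two * weight 0 (suc M) ≤ weight 0 M
      halve = begin
        two * weight 0 (suc M)          ≡⟨ *-comm two (weight 0 (suc M)) ⟩
        weight 0 (suc M) * two          ≤⟨ *-monoˡ-≤-nonNeg′ (weight 0 (suc M)) (weight-nonNeg 0 (suc M)) (ℕtoℚ-mono-≤ (ℕ.s≤s 1≤M)) ⟩
        weight 0 (suc M) * ℕtoℚ (suc M) ≡⟨ weight0-suc M ⟩
        weight 0 M                      ∎
    Φ-antitone : ∀ j → Φ (N ℕ.+ j) ≤ Φ N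
    Φ-antitone zero    rewrite ℕ.+-identityʳ N = ≤-refl
    Φ-antitone (suc j) rewrite ℕ.+-suc N j = ≤-trans (Φ-step (N ℕ.+ j) (ℕ.≤-trans 1≤N (ℕ.m≤m+n N j))) (Φ-antitone j)

module Mode (n : ℕ) .{{_ : ℕ.NonZero n}} where

  open import Data.Nat.Base
  open import Data.Nat.Properties
  open import Data.Nat.Tactic.RingSolver using (solve-∀)
  open import Data.Product.Base using (∃-syntax; _×_; proj₁; proj₂)
  open import Relation.Nullary using (¬_; contradiction)
  open import Relation.Unary using (Decidable)
  open import Algebra.Properties.CommutativeSemigroup *-commutativeSemigroup using (xy∙z≈y∙xz; xy∙z≈xz∙y)
  open Naturals

  -- Descends m says weight n (suc m) ≤ weight n m, with the factorials cleared.
  Descends : ℕ → Set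
  Descends m = suc m ^ n ≤ suc m * m ^ n

  Descends? : Decidable Descends
  Descends? m = suc m ^ n ≤? suc m * m ^ n

  ¬Descends-0 : ¬ Descends 0
  ¬Descends-0 = 1^k≰1*0^k n
    where
    1^k≰1*0^k : ∀ k .{{_ : NonZero k}} → ¬ (1 ^ k ≤ 1 * 0 ^ k)
    1^k≰1*0^k (suc k) 1≤0 = contradiction (≤-trans (≤-reflexive (sym (^-zeroˡ (suc k)))) 1≤0) λ ()

  Descends-2n : Descends (2 * n)
  Descends-2n = begin
    suc (2 * n) ^ n        ≤⟨ *-cancelʳ-≤ _ _ n halved ⟩
    2 * (2 * n) ^ n        ≤⟨ *-monoˡ-≤ ((2 * n) ^ n) (s≤s (≤-trans (>-nonZero⁻¹ n) (m≤m+n n (n + 0)))) ⟩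
    suc (2 * n) * (2 * n) ^ n ∎
    where
    open ≤-Reasoning
    [n+n+1]≡1+2n : ∀ n → n + n + 1 ≡ suc (2 * n)
    [n+n+1]≡1+2n = solve-∀
    [n+n]*p≡2*p*n : ∀ n p → (n + n) * p ≡ 2 * p * n
    [n+n]*p≡2*p*n = solve-∀
    halved : suc (2 * n) ^ n * n ≤ 2 * (2 * n) ^ n * n
    halved = subst₂ (λ x y → x ^ n * n ≤ y) ([n+n+1]≡1+2n n)
               (trans (cong (λ x → (n + n) * x ^ n) ([n+n]≡2n n)) ([n+n]*p≡2*p*n n ((2 * n) ^ n)))
               (suc-^-ratio n n)
      where
      [n+n]≡2n : ∀ n → n + n ≡ 2 * n
      [n+n]≡2n = solve-∀

  below-ascent : ∀ {a m} → ¬ Descends a → m ≤ a → suc a * m ^ n ≤ suc m ^ n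
  below-ascent {zero}  {zero} _ _ = subst (_≤ 1 ^ n) (sym (*-identityˡ (0 ^ n))) (^-monoˡ-≤ n z≤n)
  below-ascent {a@(suc _)} {m} ¬Da m≤a = *-cancelʳ-≤ _ _ (a ^ n) {{m^n≢0 a n}} (begin
    suc a * m ^ n * a ^ n    ≡⟨ xy∙z≈y∙xz (suc a) (m ^ n) (a ^ n) ⟩
    m ^ n * (suc a * a ^ n)  ≤⟨ *-monoʳ-≤ (m ^ n) (<⇒≤ (≰⇒> ¬Da)) ⟩
    m ^ n * suc a ^ n        ≡⟨ *-comm (m ^ n) (suc a ^ n) ⟩
    suc a ^ n * m ^ n        ≤⟨ suc-^-antitone n m≤a ⟩
    suc m ^ n * a ^ n        ∎)
    where open ≤-Reasoning

  above-descent : ∀ {a m} → .{{NonZero a}} → Descends a → a ≤ m → suc m ^ n ≤ suc a * m ^ n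
  above-descent {a} {m} Da a≤m = *-cancelʳ-≤ _ _ (a ^ n) {{m^n≢0 a n}} (begin
    suc m ^ n * a ^ n          ≤⟨ suc-^-antitone n a≤m ⟩
    suc a ^ n * m ^ n          ≤⟨ *-monoˡ-≤ (m ^ n) Da ⟩
    suc a * a ^ n * m ^ n      ≡⟨ xy∙z≈xz∙y (suc a) (a ^ n) (m ^ n) ⟩
    suc a * m ^ n * a ^ n      ∎)
    where open ≤-Reasoning

  private
    peak : ∃[ a ] (a < 2 * n × ¬ Descends a × Descends (suc a))
    peak = crossing Descends? ¬Descends-0 Descends-2n

  opaque
    mode : ℕ
    mode = suc (proj₁ peak)

    instance
      mode-nonZero : NonZero mode
      mode-nonZero = _

    mode≤2n : mode ≤ 2 * n
    mode≤2n = proj₁ (proj₂ peak)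

    ^-ratio-above-mode : ∀ {m} → mode ≤ m → suc m ^ n ≤ suc mode * m ^ n
    ^-ratio-above-mode = above-descent (proj₂ (proj₂ (proj₂ peak)))

    ^-ratio-below-mode : ∀ {m} → m < mode → mode * m ^ n ≤ suc m ^ n
    ^-ratio-below-mode m<mode = below-ascent (proj₁ (proj₂ (proj₂ peak))) (≤-pred m<mode)

  [1+b]*[1+2n+h]≤mode*[1+2n] : ∀ {b h} → suc b + h ≤ mode → suc b * (suc (2 * n) + h) ≤ mode * suc (2 * n)
  [1+b]*[1+2n+h]≤mode*[1+2n] {b} {h} b+1+h≤mode = begin
    suc b * (suc (2 * n) + h)          ≡⟨ *-distribˡ-+ (suc b) (suc (2 * n)) h ⟩
    suc b * suc (2 * n) + suc b * h    ≤⟨ +-monoʳ-≤ (suc b * suc (2 * n)) (*-monoˡ-≤ h 1+b≤1+2n) ⟩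
    suc b * suc (2 * n) + suc (2 * n) * h ≡⟨ cong (suc b * suc (2 * n) +_) (*-comm (suc (2 * n)) h) ⟩
    suc b * suc (2 * n) + h * suc (2 * n) ≡⟨ *-distribʳ-+ (suc (2 * n)) (suc b) h ⟨
    (suc b + h) * suc (2 * n)          ≤⟨ *-monoˡ-≤ (suc (2 * n)) b+1+h≤mode ⟩
    mode * suc (2 * n)                 ∎
    where
    open ≤-Reasoning
    1+b≤1+2n : suc b ≤ suc (2 * n)
    1+b≤1+2n = ≤-trans (≤-trans (m≤m+n (suc b) h) b+1+h≤mode) (m≤n⇒m≤1+n mode≤2n)

  [1+2n+h]*[1+mode]≤[1+b]*[1+2n] : ∀ {b h} → mode + h ≤ b → (suc (2 * n) + h) * suc mode ≤ suc b * suc (2 * n)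
  [1+2n+h]*[1+mode]≤[1+b]*[1+2n] {b} {h} mode+h≤b = begin
    (suc (2 * n) + h) * suc mode           ≡⟨ *-distribʳ-+ (suc mode) (suc (2 * n)) h ⟩
    suc (2 * n) * suc mode + h * suc mode  ≤⟨ +-monoʳ-≤ (suc (2 * n) * suc mode) (*-monoʳ-≤ h (s≤s mode≤2n)) ⟩
    suc (2 * n) * suc mode + h * suc (2 * n) ≡⟨ cong (suc (2 * n) * suc mode +_) (*-comm h (suc (2 * n))) ⟩
    suc (2 * n) * suc mode + suc (2 * n) * h ≡⟨ *-distribˡ-+ (suc (2 * n)) (suc mode) h ⟨
    suc (2 * n) * (suc mode + h)           ≤⟨ *-monoʳ-≤ (suc (2 * n)) (s≤s mode+h≤b) ⟩
    suc (2 * n) * suc b                    ≡⟨ *-comm (suc (2 * n)) (suc b) ⟩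
    suc b * suc (2 * n)                    ∎
    where open ≤-Reasoning

  near-mode-below : ∀ {m h} → m < mode + (h + h) → m + 1 ≤ (mode ∸ (h + h)) + (4 * h + 1)
  near-mode-below {m} {h} m<mode+2h = begin
    m + 1                                  ≡⟨ +-comm m 1 ⟩
    suc m                                  ≤⟨ m<mode+2h ⟩
    mode + (h + h)                         ≤⟨ +-monoˡ-≤ (h + h) (m≤n+m∸n mode (h + h)) ⟩
    (h + h) + (mode ∸ (h + h)) + (h + h)   ≡⟨ regroup (mode ∸ (h + h)) h ⟩
    (mode ∸ (h + h)) + 4 * h               ≤⟨ +-monoʳ-≤ (mode ∸ (h + h)) (m≤m+n (4 * h) 1) ⟩
    (mode ∸ (h + h)) + (4 * h + 1)         ∎
    where
    open ≤-Reasoning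
    regroup : ∀ x h → (h + h) + x + (h + h) ≡ x + 4 * h
    regroup = solve-∀

  near-mode-above : ∀ {m h} → mode < m + (h + h) → mode + (h + h) + 1 ≤ m + (4 * h + 1)
  near-mode-above {m} {h} mode<m+2h = begin
    mode + (h + h) + 1         ≡⟨ regroup₁ mode h ⟩
    suc mode + (h + h)         ≤⟨ +-monoˡ-≤ (h + h) mode<m+2h ⟩
    m + (h + h) + (h + h)      ≡⟨ regroup₂ m h ⟩
    m + 4 * h                  ≤⟨ +-monoʳ-≤ m (m≤m+n (4 * h) 1) ⟩
    m + (4 * h + 1)            ∎
    where
    open ≤-Reasoning
    regroup₁ : ∀ a h → a + (h + h) + 1 ≡ suc a + (h + h)
    regroup₁ = solve-∀
    regroup₂ : ∀ m h → m + (h + h) + (h + h) ≡ m + 4 * h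
    regroup₂ = solve-∀

  mode+2h≤T₀ : ∀ {h} → h ≤ n → mode + (h + h) ≤ 4 * suc (2 * n)
  mode+2h≤T₀ {h} h≤n = begin
    mode + (h + h)                     ≤⟨ +-mono-≤ mode≤2n (+-mono-≤ h≤n h≤n) ⟩
    2 * n + (n + n)                    ≤⟨ m≤m+n (2 * n + (n + n)) (4 * n + 4) ⟩
    2 * n + (n + n) + (4 * n + 4)      ≡⟨ 4[1+2n] n ⟩
    4 * suc (2 * n)                    ∎
    where
    open ≤-Reasoning
    4[1+2n] : ∀ n → 2 * n + (n + n) + (4 * n + 4) ≡ 4 * suc (2 * n)
    4[1+2n] = solve-∀

module Unimodality (n : ℕ) .{{_ : ℕ.NonZero n}} where

  open import Data.Nat.Base as ℕ using (suc; _!)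
  open import Data.Rational.Base
  open import Data.Rational.Properties
  open Rationals
  open Weights
  open Mode n using (mode; ^-ratio-above-mode; ^-ratio-below-mode)

  weight-ratio-below : ∀ {m} → m ℕ.< mode → weight n m * ℕtoℚ mode ≤ weight n (suc m) * ℕtoℚ (suc m)
  weight-ratio-below {m} m<mode = *-cancelʳ-≤-pos′ (ℕtoℚ (m !)) (ℕtoℚ-!-pos m) (begin
    weight n m * ℕtoℚ mode * ℕtoℚ (m !)              ≡⟨ xy∙z≈y∙xz (weight n m) (ℕtoℚ mode) (ℕtoℚ (m !)) ⟩
    ℕtoℚ mode * (weight n m * ℕtoℚ (m !))            ≡⟨ cong (ℕtoℚ mode *_) (weight*! n m) ⟩
    ℕtoℚ mode * ℕtoℚ (m ℕ.^ n)                       ≡⟨ ℕtoℚ-* mode (m ℕ.^ n) ⟨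
    ℕtoℚ (mode ℕ.* m ℕ.^ n)                          ≤⟨ ℕtoℚ-mono-≤ (^-ratio-below-mode m<mode) ⟩
    ℕtoℚ (suc m ℕ.^ n)                               ≡⟨ weight-suc*suc n m ⟨
    weight n (suc m) * ℕtoℚ (suc m) * ℕtoℚ (m !)     ∎)
    where open ≤-Reasoning

  weight-ratio-above : ∀ {m} → mode ℕ.≤ m → weight n (suc m) * ℕtoℚ (suc m) ≤ weight n m * ℕtoℚ (suc mode)
  weight-ratio-above {m} mode≤m = *-cancelʳ-≤-pos′ (ℕtoℚ (m !)) (ℕtoℚ-!-pos m) (begin
    weight n (suc m) * ℕtoℚ (suc m) * ℕtoℚ (m !)     ≡⟨ weight-suc*suc n m ⟩
    ℕtoℚ (suc m ℕ.^ n)                               ≤⟨ ℕtoℚ-mono-≤ (^-ratio-above-mode mode≤m) ⟩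
    ℕtoℚ (suc mode ℕ.* m ℕ.^ n)                      ≡⟨ ℕtoℚ-* (suc mode) (m ℕ.^ n) ⟩
    ℕtoℚ (suc mode) * ℕtoℚ (m ℕ.^ n)                 ≡⟨ cong (ℕtoℚ (suc mode) *_) (weight*! n m) ⟨
    ℕtoℚ (suc mode) * (weight n m * ℕtoℚ (m !))      ≡⟨ x∙yz≈yx∙z (ℕtoℚ (suc mode)) (weight n m) (ℕtoℚ (m !)) ⟩
    weight n m * ℕtoℚ (suc mode) * ℕtoℚ (m !)        ∎)
    where open ≤-Reasoning

module Decay (n : ℕ) .{{_ : ℕ.NonZero n}} (h : ℕ) where

  open import Data.Nat.Base as ℕ using (suc; _∸_)
  import Data.Nat.Properties as ℕ
  open import Data.Rational.Base
  open import Data.Rational.Properties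
  open import Data.Sum.Base using (_⊎_; inj₁; inj₂)
  open import Relation.Nullary using (yes; no; contradiction)
  open import Relation.Nullary.Decidable using (_⊎-dec_)
  open import Relation.Unary using (Decidable)
  open Rationals
  open FiniteSums
  open RatioChains
  open Weights
  open Mode n
  open Unimodality n

  w : ℕ → ℚ
  w = weight n

  -- At distance more than h from the mode, each step multiplies the weight by at most D / C.
  B D C : ℚ
  B = ℕtoℚ (bell n)
  D = ℕtoℚ (suc (2 ℕ.* n))
  C = ℕtoℚ (suc (2 ℕ.* n) ℕ.+ h)

  B-nonNeg : 0ℚ ≤ B
  B-nonNeg = ℕtoℚ-nonNeg (bell n)

  D-nonNeg : 0ℚ ≤ D
  D-nonNeg = ℕtoℚ-nonNeg (suc (2 ℕ.* n))

  C-nonNeg : 0ℚ ≤ C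
  C-nonNeg = ℕtoℚ-nonNeg (suc (2 ℕ.* n) ℕ.+ h)

  weight-step-up : ∀ b → suc b ℕ.+ h ℕ.≤ mode → w b * C ≤ w (suc b) * D
  weight-step-up b b+1+h≤mode = *-cancelʳ-≤-pos′ (ℕtoℚ mode) (ℕtoℚ-pos mode) (begin
    w b * C * ℕtoℚ mode              ≡⟨ xy∙z≈xz∙y (w b) C (ℕtoℚ mode) ⟩
    w b * ℕtoℚ mode * C              ≤⟨ *-monoʳ-≤-nonNeg′ C C-nonNeg (weight-ratio-below (ℕ.≤-trans (ℕ.m≤m+n (suc b) h) b+1+h≤mode)) ⟩
    w (suc b) * ℕtoℚ (suc b) * C     ≡⟨ *-assoc (w (suc b)) (ℕtoℚ (suc b)) C ⟩
    w (suc b) * (ℕtoℚ (suc b) * C)   ≤⟨ *-monoˡ-≤-nonNeg′ (w (suc b)) (weight-nonNeg n (suc b)) [1+b]C≤mode*D ⟩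
    w (suc b) * (ℕtoℚ mode * D)      ≡⟨ x∙yz≈xz∙y (w (suc b)) (ℕtoℚ mode) D ⟩
    w (suc b) * D * ℕtoℚ mode        ∎)
    where
    open ≤-Reasoning
    [1+b]C≤mode*D : ℕtoℚ (suc b) * C ≤ ℕtoℚ mode * D
    [1+b]C≤mode*D = subst₂ _≤_ (ℕtoℚ-* (suc b) (suc (2 ℕ.* n) ℕ.+ h)) (ℕtoℚ-* mode (suc (2 ℕ.* n)))
                        (ℕtoℚ-mono-≤ ([1+b]*[1+2n+h]≤mode*[1+2n] b+1+h≤mode))

  weight-step-down : ∀ b → mode ℕ.+ h ℕ.≤ b → w (suc b) * C ≤ w b * D
  weight-step-down b mode+h≤b = *-cancelʳ-≤-pos′ (ℕtoℚ (suc mode)) (ℕtoℚ-pos (suc mode)) (begin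
    w (suc b) * C * ℕtoℚ (suc mode)      ≡⟨ *-assoc (w (suc b)) C (ℕtoℚ (suc mode)) ⟩
    w (suc b) * (C * ℕtoℚ (suc mode))    ≤⟨ *-monoˡ-≤-nonNeg′ (w (suc b)) (weight-nonNeg n (suc b)) C[1+mode]≤[1+b]D ⟩
    w (suc b) * (ℕtoℚ (suc b) * D)       ≡⟨ *-assoc (w (suc b)) (ℕtoℚ (suc b)) D ⟨
    w (suc b) * ℕtoℚ (suc b) * D         ≤⟨ *-monoʳ-≤-nonNeg′ D D-nonNeg (weight-ratio-above (ℕ.≤-trans (ℕ.m≤m+n mode h) mode+h≤b)) ⟩
    w b * ℕtoℚ (suc mode) * D            ≡⟨ xy∙z≈xz∙y (w b) (ℕtoℚ (suc mode)) D ⟩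
    w b * D * ℕtoℚ (suc mode)            ∎)
    where
    open ≤-Reasoning
    C[1+mode]≤[1+b]D : C * ℕtoℚ (suc mode) ≤ ℕtoℚ (suc b) * D
    C[1+mode]≤[1+b]D = subst₂ _≤_ (ℕtoℚ-* (suc (2 ℕ.* n) ℕ.+ h) (suc mode)) (ℕtoℚ-* (suc b) (suc (2 ℕ.* n)))
                           (ℕtoℚ-mono-≤ ([1+2n+h]*[1+mode]≤[1+b]*[1+2n] mode+h≤b))

  Far : ℕ → Set
  Far m = m ℕ.+ (h ℕ.+ h) ℕ.≤ mode ⊎ mode ℕ.+ (h ℕ.+ h) ℕ.≤ m

  Far? : Decidable Far
  Far? m = (m ℕ.+ (h ℕ.+ h) ℕ.≤? mode) ⊎-dec (mode ℕ.+ (h ℕ.+ h) ℕ.≤? m)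

  weight-far : ∀ {m} → Far m → w m * C ^ℚ h ≤ B * D ^ℚ h
  weight-far {m} (inj₁ m+2h≤mode) = begin
    w m * C ^ℚ h               ≤⟨ ratio-chain-up w C-nonNeg D-nonNeg m h (λ i i<h → weight-step-up (m ℕ.+ i) (in-range i i<h)) ⟩
    w (m ℕ.+ h) * D ^ℚ h       ≤⟨ *-monoʳ-≤-nonNeg′ (D ^ℚ h) (^ℚ-nonNeg h D-nonNeg) (weight≤bell n (m ℕ.+ h)) ⟩
    B * D ^ℚ h                 ∎
    where
    open ≤-Reasoning
    in-range : ∀ i → i ℕ.< h → suc (m ℕ.+ i) ℕ.+ h ℕ.≤ mode
    in-range i i<h = ℕ.≤-trans (ℕ.+-monoˡ-≤ h (ℕ.≤-trans (ℕ.≤-reflexive (sym (ℕ.+-suc m i))) (ℕ.+-monoʳ-≤ m i<h)))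
                       (ℕ.≤-trans (ℕ.≤-reflexive (ℕ.+-assoc m h h)) m+2h≤mode)
  weight-far {m} (inj₂ mode+2h≤m) = begin
    w m * C ^ℚ h                   ≡⟨ cong (λ x → w x * C ^ℚ h) (ℕ.m∸n+n≡m h≤m) ⟨
    w (m ∸ h ℕ.+ h) * C ^ℚ h       ≤⟨ ratio-chain-down w C-nonNeg D-nonNeg (m ∸ h) h (λ i _ → weight-step-down (m ∸ h ℕ.+ i) (in-range i)) ⟩
    w (m ∸ h) * D ^ℚ h             ≤⟨ *-monoʳ-≤-nonNeg′ (D ^ℚ h) (^ℚ-nonNeg h D-nonNeg) (weight≤bell n (m ∸ h)) ⟩
    B * D ^ℚ h                     ∎
    where
    open ≤-Reasoning
    mode+h≤m∸h : mode ℕ.+ h ℕ.≤ m ∸ h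
    mode+h≤m∸h = ℕ.m+n≤o⇒m≤o∸n (mode ℕ.+ h) (ℕ.≤-trans (ℕ.≤-reflexive (ℕ.+-assoc mode h h)) mode+2h≤m)
    h≤m : h ℕ.≤ m
    h≤m = ℕ.≤-trans (ℕ.m≤n+m h (mode ℕ.+ h)) (ℕ.≤-trans (ℕ.≤-reflexive (ℕ.+-assoc mode h h)) mode+2h≤m)
    in-range : ∀ i → mode ℕ.+ h ℕ.≤ m ∸ h ℕ.+ i
    in-range i = ℕ.≤-trans mode+h≤m∸h (ℕ.m≤m+n (m ∸ h) i)

  T₀ : ℕ
  T₀ = 4 ℕ.* suc (2 ℕ.* n)

  v : ℕ → ℚ
  v m = ℕtoℚ (suc m) * w m

  v-nonNeg : ∀ m → 0ℚ ≤ v m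
  v-nonNeg m = *-nonNeg (ℕtoℚ-nonNeg (suc m)) (weight-nonNeg n m)

  v-halves : ∀ m → T₀ ℕ.≤ m → v (suc m) * two ≤ v m * 1ℚ
  v-halves m T₀≤m = begin
    v (suc m) * two                              ≡⟨ xy∙z≈y∙xz (ℕtoℚ (suc (suc m))) (w (suc m)) two ⟩
    w (suc m) * (ℕtoℚ (suc (suc m)) * two)       ≡⟨ cong (w (suc m) *_) (ℕtoℚ-* (suc (suc m)) 2) ⟨
    w (suc m) * ℕtoℚ (suc (suc m) ℕ.* 2)         ≤⟨ *-monoˡ-≤-nonNeg′ (w (suc m)) (weight-nonNeg n (suc m)) (ℕtoℚ-mono-≤ [2+m]*2≤[1+m]*4) ⟩
    w (suc m) * ℕtoℚ (suc m ℕ.* 4)               ≡⟨ trans (cong (w (suc m) *_) (ℕtoℚ-* (suc m) 4)) (sym (*-assoc (w (suc m)) _ _)) ⟩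
    w (suc m) * ℕtoℚ (suc m) * ℕtoℚ 4            ≤⟨ *-monoʳ-≤-nonNeg′ (ℕtoℚ 4) (ℕtoℚ-nonNeg 4) (weight-ratio-above mode≤m) ⟩
    w m * ℕtoℚ (suc mode) * ℕtoℚ 4               ≡⟨ trans (*-assoc (w m) _ _) (cong (w m *_) (sym (ℕtoℚ-* (suc mode) 4))) ⟩
    w m * ℕtoℚ (suc mode ℕ.* 4)                  ≤⟨ *-monoˡ-≤-nonNeg′ (w m) (weight-nonNeg n m) (ℕtoℚ-mono-≤ [1+mode]*4≤1+m) ⟩
    w m * ℕtoℚ (suc m)                           ≡⟨ *-comm (w m) (ℕtoℚ (suc m)) ⟩
    v m                                          ≡⟨ *-identityʳ (v m) ⟨
    v m * 1ℚ                                     ∎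
    where
    open ≤-Reasoning
    [1+mode]*4≤T₀ : suc mode ℕ.* 4 ℕ.≤ T₀
    [1+mode]*4≤T₀ = ℕ.≤-trans (ℕ.≤-reflexive (ℕ.*-comm (suc mode) 4)) (ℕ.*-monoʳ-≤ 4 (ℕ.s≤s mode≤2n))
    mode≤m : mode ℕ.≤ m
    mode≤m = ℕ.≤-trans (ℕ.≤-trans (ℕ.n≤1+n mode) (ℕ.≤-trans (ℕ.m≤m*n (suc mode) 4) [1+mode]*4≤T₀)) T₀≤m
    [1+mode]*4≤1+m : suc mode ℕ.* 4 ℕ.≤ suc m
    [1+mode]*4≤1+m = ℕ.≤-trans [1+mode]*4≤T₀ (ℕ.≤-trans T₀≤m (ℕ.n≤1+n m))
    [2+m]*2≤[1+m]*4 : suc (suc m) ℕ.* 2 ℕ.≤ suc m ℕ.* 4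
    [2+m]*2≤[1+m]*4 = ℕ.≤-trans (ℕ.*-monoˡ-≤ 2 (ℕ.s≤s (ℕ.s≤s (ℕ.m≤m*n m 2)))) (ℕ.≤-reflexive (ℕ.*-assoc (suc m) 2 2))

  v-tail : ∀ j → v (T₀ ℕ.+ j) * two ^ℚ j ≤ v T₀
  v-tail j = subst (v (T₀ ℕ.+ j) * two ^ℚ j ≤_) (trans (cong (v T₀ *_) (1^ℚ≡1 j)) (*-identityʳ (v T₀)))
    (ratio-chain-down v (ℕtoℚ-nonNeg 2) (ℕtoℚ-nonNeg 1) T₀ j (λ i _ → v-halves (T₀ ℕ.+ i) (ℕ.m≤m+n T₀ i)))

  -- The factor m + 1 in v lets farWeight also absorb m · w m in the estimates for the mean.
  farWeight : ℕ → ℚ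
  farWeight m with Far? m
  ... | yes _ = v m
  ... | no  _ = 0ℚ

  farWeight-nonNeg : ∀ m → 0ℚ ≤ farWeight m
  farWeight-nonNeg m with Far? m
  ... | yes _ = v-nonNeg m
  ... | no  _ = ≤-refl

  farWeight-far : ∀ {m} → Far m → farWeight m ≡ v m
  farWeight-far {m} far with Far? m
  ... | yes _   = refl
  ... | no ¬far = contradiction far ¬far

  K : ℚ
  K = ℕtoℚ (suc T₀) * (B * D ^ℚ h)

  farSum-bound : mode ℕ.+ (h ℕ.+ h) ℕ.≤ T₀ → ∀ L → sumℚ L farWeight * C ^ℚ h ≤ ℕtoℚ (T₀ ℕ.+ 2) * K
  farSum-bound T₀-far L = subst (_≤ ℕtoℚ (T₀ ℕ.+ 2) * K) (sumℚ-*ʳ L farWeight (C ^ℚ h))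
    (geometric-tail-bound T₀ K (λ m → farWeight m * C ^ℚ h) K-nonNeg
      (λ m → *-nonNeg (farWeight-nonNeg m) (^ℚ-nonNeg h C-nonNeg)) head tail L)
    where
    K-nonNeg : 0ℚ ≤ K
    K-nonNeg = *-nonNeg (ℕtoℚ-nonNeg (suc T₀)) (*-nonNeg B-nonNeg (^ℚ-nonNeg h D-nonNeg))
    v-far : ∀ {m} → Far m → m ℕ.≤ T₀ → v m * C ^ℚ h ≤ K
    v-far {m} far m≤T₀ = begin
      ℕtoℚ (suc m) * w m * C ^ℚ h      ≡⟨ *-assoc (ℕtoℚ (suc m)) (w m) (C ^ℚ h) ⟩
      ℕtoℚ (suc m) * (w m * C ^ℚ h)    ≤⟨ *-mono-≤-nonNeg (ℕtoℚ-nonNeg (suc T₀)) (*-nonNeg (weight-nonNeg n m) (^ℚ-nonNeg h C-nonNeg))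
                                            (ℕtoℚ-mono-≤ (ℕ.s≤s m≤T₀)) (weight-far far) ⟩
      K                                ∎
      where open ≤-Reasoning
    head : ∀ m → m ℕ.< T₀ → farWeight m * C ^ℚ h ≤ K
    head m m<T₀ with Far? m
    ... | yes far = v-far far (ℕ.<⇒≤ m<T₀)
    ... | no  _   = subst (_≤ K) (sym (*-zeroˡ (C ^ℚ h))) K-nonNeg
    tail : ∀ i → farWeight (T₀ ℕ.+ i) * C ^ℚ h * two ^ℚ i ≤ K
    tail i with Far? (T₀ ℕ.+ i)
    ... | yes _ = begin
      v (T₀ ℕ.+ i) * C ^ℚ h * two ^ℚ i   ≡⟨ xy∙z≈xz∙y (v (T₀ ℕ.+ i)) (C ^ℚ h) (two ^ℚ i) ⟩
      v (T₀ ℕ.+ i) * two ^ℚ i * C ^ℚ h   ≤⟨ *-monoʳ-≤-nonNeg′ (C ^ℚ h) (^ℚ-nonNeg h C-nonNeg) (v-tail i) ⟩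
      v T₀ * C ^ℚ h                      ≤⟨ v-far (inj₂ T₀-far) ℕ.≤-refl ⟩
      K                                  ∎
      where open ≤-Reasoning
    ... | no _ = subst (_≤ K) (sym (trans (cong (_* two ^ℚ i) (*-zeroˡ (C ^ℚ h))) (*-zeroˡ (two ^ℚ i)))) K-nonNeg

module Concentration (n : ℕ) .{{_ : ℕ.NonZero n}} (h Z : ℕ) (h≤n : h ℕ.≤ n)
  (gain : (Decay.T₀ n h ℕ.+ 2) ℕ.* ℕ.suc (Decay.T₀ n h) ℕ.* ℕ.suc (2 ℕ.* n) ℕ.^ h ℕ.* Z
            ℕ.≤ (ℕ.suc (2 ℕ.* n) ℕ.+ h) ℕ.^ h)
  (Z-large : 2 ℕ.* ℕ.suc (2 ℕ.* n) ℕ.≤ Z) where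

  open import Data.Nat.Base as ℕ using (zero; suc; _∸_)
  import Data.Nat.Properties as ℕ
  open import Data.Rational.Base
  open import Data.Rational.Properties
  open import Data.Sum.Base using (inj₁; inj₂)
  open import Function.Base using (_∘_)
  open import Data.Bool.Base using (if_then_else_)
  open import Relation.Nullary using (¬_; Dec; does; yes; no; contradiction)
  open import Tactic.RingSolver using (solve-∀)
  open Rationals
  open FiniteSums
  open Weights
  open Dobinski
  open Mode n using (mode; mode≤2n; mode+2h≤T₀; near-mode-below; near-mode-above)
  open Decay n h

  T₀-far : mode ℕ.+ (h ℕ.+ h) ℕ.≤ T₀
  T₀-far = mode+2h≤T₀ h≤n

  2[1+mode]≤Z : 2 ℕ.* suc mode ℕ.≤ Z
  2[1+mode]≤Z = ℕ.≤-trans (ℕ.*-monoʳ-≤ 2 (ℕ.s≤s mode≤2n)) Z-large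

  farSum : ℕ → ℚ
  farSum L = sumℚ L farWeight

  farSum-nonNeg : ∀ L → 0ℚ ≤ farSum L
  farSum-nonNeg L = sumℚ-nonNeg L farWeight-nonNeg

  farSum*Z≤bell : ∀ L → farSum L * ℕtoℚ Z ≤ B
  farSum*Z≤bell L = *-cancelʳ-≤-pos′ (C ^ℚ h) (^ℚ-pos h (ℕtoℚ-pos (suc (2 ℕ.* n) ℕ.+ h))) (begin
    farSum L * ℕtoℚ Z * C ^ℚ h                 ≡⟨ xy∙z≈xz∙y (farSum L) (ℕtoℚ Z) (C ^ℚ h) ⟩
    farSum L * C ^ℚ h * ℕtoℚ Z                 ≤⟨ *-monoʳ-≤-nonNeg′ (ℕtoℚ Z) (ℕtoℚ-nonNeg Z) (farSum-bound T₀-far L) ⟩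
    ℕtoℚ (T₀ ℕ.+ 2) * K * ℕtoℚ Z               ≡⟨ regroup (ℕtoℚ (T₀ ℕ.+ 2)) (ℕtoℚ (suc T₀)) B (D ^ℚ h) (ℕtoℚ Z) ⟩
    B * (ℕtoℚ (T₀ ℕ.+ 2) * ℕtoℚ (suc T₀) * D ^ℚ h * ℕtoℚ Z)
                                               ≡⟨ cong (B *_) gain-ℚ ⟨
    B * ℕtoℚ ((T₀ ℕ.+ 2) ℕ.* suc T₀ ℕ.* suc (2 ℕ.* n) ℕ.^ h ℕ.* Z)
                                               ≤⟨ *-monoˡ-≤-nonNeg′ B B-nonNeg (ℕtoℚ-mono-≤ gain) ⟩
    B * ℕtoℚ ((suc (2 ℕ.* n) ℕ.+ h) ℕ.^ h)     ≡⟨ cong (B *_) (ℕtoℚ-^ (suc (2 ℕ.* n) ℕ.+ h) h) ⟩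
    B * C ^ℚ h                                 ∎)
    where
    open ≤-Reasoning
    regroup : ∀ a b x d z → a * (b * (x * d)) * z ≡ x * (a * b * d * z)
    regroup = solve-∀ ring
    gain-ℚ : ℕtoℚ ((T₀ ℕ.+ 2) ℕ.* suc T₀ ℕ.* suc (2 ℕ.* n) ℕ.^ h ℕ.* Z)
             ≡ ℕtoℚ (T₀ ℕ.+ 2) * ℕtoℚ (suc T₀) * D ^ℚ h * ℕtoℚ Z
    gain-ℚ = begin-equality
      ℕtoℚ ((T₀ ℕ.+ 2) ℕ.* suc T₀ ℕ.* suc (2 ℕ.* n) ℕ.^ h ℕ.* Z)
        ≡⟨ ℕtoℚ-* ((T₀ ℕ.+ 2) ℕ.* suc T₀ ℕ.* suc (2 ℕ.* n) ℕ.^ h) Z ⟩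
      ℕtoℚ ((T₀ ℕ.+ 2) ℕ.* suc T₀ ℕ.* suc (2 ℕ.* n) ℕ.^ h) * ℕtoℚ Z
        ≡⟨ cong (_* ℕtoℚ Z) (ℕtoℚ-* ((T₀ ℕ.+ 2) ℕ.* suc T₀) (suc (2 ℕ.* n) ℕ.^ h)) ⟩
      ℕtoℚ ((T₀ ℕ.+ 2) ℕ.* suc T₀) * ℕtoℚ (suc (2 ℕ.* n) ℕ.^ h) * ℕtoℚ Z
        ≡⟨ cong₂ (λ x y → x * y * ℕtoℚ Z) (ℕtoℚ-* (T₀ ℕ.+ 2) (suc T₀)) (ℕtoℚ-^ (suc (2 ℕ.* n)) h) ⟩
      ℕtoℚ (T₀ ℕ.+ 2) * ℕtoℚ (suc T₀) * D ^ℚ h * ℕtoℚ Z ∎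

  -- N makes the tail error 2/N! of expSum N negligible, and L′ = N + (n + 1) lets dobinski-lower
  -- for both exponents n and n + 1 see at least expSum N.
  c N L′ : ℕ
  c  = mode ℕ.+ (h ℕ.+ h)
  N  = 4 ℕ.* suc c
  L′ = N ℕ.+ suc n

  S U : ℚ
  S = sumℚ L′ w
  U = sumℚ L′ (weight (suc n))

  w≤v : ∀ m → w m ≤ v m
  w≤v m = subst (_≤ v m) (*-identityˡ (w m)) (*-monoʳ-≤-nonNeg′ (w m) (weight-nonNeg n m) (ℕtoℚ-mono-≤ {1} {suc m} (ℕ.s≤s ℕ.z≤n)))

  index≤c+far : ∀ m → ℕtoℚ m * w m ≤ w m * ℕtoℚ c + farWeight m
  index≤c+far m with ℕ.≤-total c m
  ... | inj₁ c≤m = ≤-+ˡ-nonNeg _ (*-nonNeg (weight-nonNeg n m) (ℕtoℚ-nonNeg c)) (begin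
    ℕtoℚ m * w m        ≤⟨ *-monoʳ-≤-nonNeg′ (w m) (weight-nonNeg n m) (ℕtoℚ-mono-≤ (ℕ.n≤1+n m)) ⟩
    v m                 ≡⟨ farWeight-far (inj₂ c≤m) ⟨
    farWeight m         ∎)
    where open ≤-Reasoning
  ... | inj₂ m≤c = ≤-+ʳ-nonNeg _ (farWeight-nonNeg m)
    (≤-trans (*-monoʳ-≤-nonNeg′ (w m) (weight-nonNeg n m) (ℕtoℚ-mono-≤ m≤c)) (≤-reflexive (*-comm (ℕtoℚ c) (w m))))

  mode∸2h≤index+far : ∀ m → w m * ℕtoℚ (mode ∸ (h ℕ.+ h)) ≤ ℕtoℚ m * w m + farWeight m * ℕtoℚ mode
  mode∸2h≤index+far m with ℕ.≤-total (m ℕ.+ (h ℕ.+ h)) mode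
  ... | inj₁ m+2h≤mode = ≤-+ˡ-nonNeg _ (*-nonNeg (ℕtoℚ-nonNeg m) (weight-nonNeg n m)) (begin
    w m * ℕtoℚ (mode ∸ (h ℕ.+ h))  ≤⟨ *-monoˡ-≤-nonNeg′ (w m) (weight-nonNeg n m) (ℕtoℚ-mono-≤ (ℕ.m∸n≤m mode (h ℕ.+ h))) ⟩
    w m * ℕtoℚ mode                ≤⟨ *-monoʳ-≤-nonNeg′ (ℕtoℚ mode) (ℕtoℚ-nonNeg mode) (w≤v m) ⟩
    v m * ℕtoℚ mode                ≡⟨ cong (_* ℕtoℚ mode) (farWeight-far {m} (inj₁ m+2h≤mode)) ⟨
    farWeight m * ℕtoℚ mode        ∎)
    where open ≤-Reasoning
  ... | inj₂ mode≤m+2h = ≤-+ʳ-nonNeg _ (*-nonNeg (farWeight-nonNeg m) (ℕtoℚ-nonNeg mode))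
    (≤-trans (*-monoˡ-≤-nonNeg′ (w m) (weight-nonNeg n m) (ℕtoℚ-mono-≤ mode∸2h≤m)) (≤-reflexive (*-comm (w m) (ℕtoℚ m))))
    where
    mode∸2h≤m : mode ∸ (h ℕ.+ h) ℕ.≤ m
    mode∸2h≤m = ℕ.m≤n+o⇒m∸n≤o mode (h ℕ.+ h) (ℕ.≤-trans mode≤m+2h (ℕ.≤-reflexive (ℕ.+-comm m (h ℕ.+ h))))

  U≤S*c+farSum : U ≤ S * ℕtoℚ c + farSum L′
  U≤S*c+farSum = begin
    U                                                ≡⟨ sumℚ-cong L′ (λ m _ → weight-suc-exponent n m) ⟩
    sumℚ L′ (λ m → ℕtoℚ m * w m)                     ≤⟨ sumℚ-mono-≤ L′ (λ m _ → index≤c+far m) ⟩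
    sumℚ L′ (λ m → w m * ℕtoℚ c + farWeight m)       ≡⟨ sumℚ-+ L′ (λ m → w m * ℕtoℚ c) farWeight ⟩
    sumℚ L′ (λ m → w m * ℕtoℚ c) + farSum L′         ≡⟨ cong (_+ farSum L′) (sumℚ-*ʳ L′ w (ℕtoℚ c)) ⟩
    S * ℕtoℚ c + farSum L′                           ∎
    where open ≤-Reasoning

  S*[mode∸2h]≤U+farSum*mode : S * ℕtoℚ (mode ∸ (h ℕ.+ h)) ≤ U + farSum L′ * ℕtoℚ mode
  S*[mode∸2h]≤U+farSum*mode = begin
    S * ℕtoℚ (mode ∸ (h ℕ.+ h))                                ≡⟨ sumℚ-*ʳ L′ w _ ⟨
    sumℚ L′ (λ m → w m * ℕtoℚ (mode ∸ (h ℕ.+ h)))               ≤⟨ sumℚ-mono-≤ L′ (λ m _ → mode∸2h≤index+far m) ⟩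
    sumℚ L′ (λ m → ℕtoℚ m * w m + farWeight m * ℕtoℚ mode)      ≡⟨ sumℚ-+ L′ (λ m → ℕtoℚ m * w m) (λ m → farWeight m * ℕtoℚ mode) ⟩
    sumℚ L′ (λ m → ℕtoℚ m * w m) + sumℚ L′ (λ m → farWeight m * ℕtoℚ mode)
      ≡⟨ cong₂ _+_ (sumℚ-cong L′ (λ m _ → weight-suc-exponent n m)) (sym (sumℚ-*ʳ L′ farWeight (ℕtoℚ mode))) ⟨
    U + farSum L′ * ℕtoℚ mode                                  ∎
    where open ≤-Reasoning

  e e′ W z : ℚ
  e  = expSum N
  e′ = expSum L′
  W  = weight 0 N
  z  = ℕtoℚ Z

  1≤N : 1 ℕ.≤ N
  1≤N = ℕ.s≤s ℕ.z≤n

  1≤e : 1ℚ ≤ e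
  1≤e = expSum-mono-≤ 1≤N

  e′≤e+2W : e′ ≤ e + two * W
  e′≤e+2W = expSum-tail 1≤N (ℕ.m≤m+n N (suc n))

  bell[1+n]*e≤U : ℕtoℚ (bell (suc n)) * e ≤ U
  bell[1+n]*e≤U = subst (λ l → ℕtoℚ (bell (suc n)) * expSum l ≤ U) (ℕ.m+n∸n≡m N (suc n)) (dobinski-lower (suc n) L′)

  bell*e≤S : B * e ≤ S
  bell*e≤S = ≤-trans (*-monoˡ-≤-nonNeg′ B B-nonNeg (expSum-mono-≤ N≤L′∸n)) (dobinski-lower n L′)
    where
    N≤L′∸n : N ℕ.≤ L′ ∸ n
    N≤L′∸n = ℕ.m+n≤o⇒m≤o∸n N (ℕ.+-monoʳ-≤ N (ℕ.n≤1+n n))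

  z-pos : 0ℚ < z
  z-pos = ℕtoℚ-pos Z {{ℕ.>-nonZero (ℕ.≤-trans (ℕ.s≤s ℕ.z≤n) 2[1+mode]≤Z)}}

  two*≤z : ∀ {m} → m ℕ.≤ suc mode → two * ℕtoℚ m ≤ z
  two*≤z {m} m≤1+mode = subst (_≤ z) (ℕtoℚ-* 2 m) (ℕtoℚ-mono-≤ (ℕ.≤-trans (ℕ.*-monoʳ-≤ 2 m≤1+mode) 2[1+mode]≤Z))

  4*[b*W]≤1 : ∀ {b} → b ≤ ℕtoℚ c + 1ℚ → ℕtoℚ 4 * (b * W) ≤ 1ℚ
  4*[b*W]≤1 {b} b≤c+1 = begin
    ℕtoℚ 4 * (b * W)                 ≤⟨ *-monoˡ-≤-nonNeg′ (ℕtoℚ 4) (ℕtoℚ-nonNeg 4) (*-monoʳ-≤-nonNeg′ W (weight-nonNeg 0 N) b≤c+1) ⟩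
    ℕtoℚ 4 * ((ℕtoℚ c + 1ℚ) * W)     ≡⟨ regroup (ℕtoℚ 4) (ℕtoℚ c) W ⟩
    W * (ℕtoℚ 4 * (1ℚ + ℕtoℚ c))     ≡⟨ cong (λ x → W * (ℕtoℚ 4 * x)) (ℕtoℚ-+ 1 c) ⟨
    W * (ℕtoℚ 4 * ℕtoℚ (suc c))      ≡⟨ cong (W *_) (ℕtoℚ-* 4 (suc c)) ⟨
    W * ℕtoℚ N                       ≤⟨ weight0*≤1 N ⟩
    1ℚ                               ∎
    where
    open ≤-Reasoning
    regroup : ∀ f c w → f * ((c + 1ℚ) * w) ≡ w * (f * (1ℚ + c))
    regroup = solve-∀ ring

  mean≤c+1 : mean n ≤ ℕtoℚ c + 1ℚ
  mean≤c+1 = ≤+1-by-perturbation (ℕtoℚ-nonNeg c) 1≤e z-pos e′≤e+2W (4*[b*W]≤1 c≤c+1)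
    (subst (_≤ z) (*-identityʳ two) (two*≤z (ℕ.s≤s ℕ.z≤n)))
    (*-cancelˡ-≤-pos′ B (ℕtoℚ-bell-pos n) (begin
      B * (mean n * (e * z))                 ≡⟨ regroup₁ B (mean n) e z ⟩
      mean n * B * e * z                     ≡⟨ cong (λ x → x * e * z) (mean*bell n) ⟩
      ℕtoℚ (bell (suc n)) * e * z            ≤⟨ *-monoʳ-≤-nonNeg′ z (<⇒≤ z-pos) bell[1+n]*e≤U ⟩
      U * z                                  ≤⟨ *-monoʳ-≤-nonNeg′ z (<⇒≤ z-pos) U≤S*c+farSum ⟩
      (S * ℕtoℚ c + farSum L′) * z
        ≤⟨ *-monoʳ-≤-nonNeg′ z (<⇒≤ z-pos) (+-monoˡ-≤ (farSum L′) (*-monoʳ-≤-nonNeg′ (ℕtoℚ c) (ℕtoℚ-nonNeg c) (dobinski-upper n L′))) ⟩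
      (B * e′ * ℕtoℚ c + farSum L′) * z      ≡⟨ regroup₂ B e′ (ℕtoℚ c) (farSum L′) z ⟩
      B * (ℕtoℚ c * (e′ * z)) + farSum L′ * z ≤⟨ +-monoʳ-≤ (B * (ℕtoℚ c * (e′ * z))) (farSum*Z≤bell L′) ⟩
      B * (ℕtoℚ c * (e′ * z)) + B            ≡⟨ B*x+B≡B*[x+1] B (ℕtoℚ c * (e′ * z)) ⟩
      B * (ℕtoℚ c * (e′ * z) + 1ℚ)           ∎))
    where
    open ≤-Reasoning
    c≤c+1 : ℕtoℚ c ≤ ℕtoℚ c + 1ℚ
    c≤c+1 = ≤-+ʳ-nonNeg 1ℚ (ℕtoℚ-nonNeg 1) ≤-refl
    regroup₁ : ∀ b m e z → b * (m * (e * z)) ≡ m * b * e * z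
    regroup₁ = solve-∀ ring
    regroup₂ : ∀ b e c g z → (b * e * c + g) * z ≡ b * (c * (e * z)) + g * z
    regroup₂ = solve-∀ ring
    B*x+B≡B*[x+1] : ∀ b x → b * x + b ≡ b * (x + 1ℚ)
    B*x+B≡B*[x+1] = solve-∀ ring

  mode∸2h≤mean+1 : ℕtoℚ (mode ∸ (h ℕ.+ h)) ≤ mean n + 1ℚ
  mode∸2h≤mean+1 = ≤+1-by-perturbation (mean-nonNeg n) 1≤e z-pos e′≤e+2W (4*[b*W]≤1 mean≤c+1)
    (two*≤z (ℕ.n≤1+n mode))
    (*-cancelˡ-≤-pos′ B (ℕtoℚ-bell-pos n) (begin
      B * (a * (e * z))                              ≡⟨ regroup₁ B a e z ⟩
      B * e * a * z
        ≤⟨ *-monoʳ-≤-nonNeg′ z (<⇒≤ z-pos) (*-monoʳ-≤-nonNeg′ a (ℕtoℚ-nonNeg (mode ∸ (h ℕ.+ h))) bell*e≤S) ⟩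
      S * a * z                                      ≤⟨ *-monoʳ-≤-nonNeg′ z (<⇒≤ z-pos) S*[mode∸2h]≤U+farSum*mode ⟩
      (U + farSum L′ * ℕtoℚ mode) * z                ≤⟨ *-monoʳ-≤-nonNeg′ z (<⇒≤ z-pos) (+-monoˡ-≤ _ (dobinski-upper (suc n) L′)) ⟩
      (ℕtoℚ (bell (suc n)) * e′ + farSum L′ * ℕtoℚ mode) * z
                                                     ≡⟨ cong (λ x → (x * e′ + farSum L′ * ℕtoℚ mode) * z) (mean*bell n) ⟨
      (mean n * B * e′ + farSum L′ * ℕtoℚ mode) * z  ≡⟨ regroup₂ (mean n) B e′ (farSum L′) (ℕtoℚ mode) z ⟩
      B * (mean n * (e′ * z)) + ℕtoℚ mode * (farSum L′ * z)
        ≤⟨ +-monoʳ-≤ (B * (mean n * (e′ * z))) (*-monoˡ-≤-nonNeg′ (ℕtoℚ mode) (ℕtoℚ-nonNeg mode) (farSum*Z≤bell L′)) ⟩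
      B * (mean n * (e′ * z)) + ℕtoℚ mode * B        ≡⟨ B*x+y*B≡B*[x+y] B (mean n * (e′ * z)) (ℕtoℚ mode) ⟩
      B * (mean n * (e′ * z) + ℕtoℚ mode)            ∎))
    where
    open ≤-Reasoning
    a : ℚ
    a = ℕtoℚ (mode ∸ (h ℕ.+ h))
    regroup₁ : ∀ b a e z → b * (a * (e * z)) ≡ b * e * a * z
    regroup₁ = solve-∀ ring
    regroup₂ : ∀ m b e g k z → (m * b * e + g * k) * z ≡ b * (m * (e * z)) + k * (g * z)
    regroup₂ = solve-∀ ring
    B*x+y*B≡B*[x+y] : ∀ b x y → b * x + y * b ≡ b * (x + y)
    B*x+y*B≡B*[x+y] = solve-∀ ring

  d : ℕ
  d = 4 ℕ.* h ℕ.+ 1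

  near⇒close : ∀ {m} → ¬ Far m → (ℕtoℚ m - mean n) ^ℚ 4 ≤ ℕtoℚ d ^ℚ 4
  near⇒close {m} ¬far = [p-q]^4≤c^4 m≤mean+d mean≤m+d
    where
    m≤mean+d : ℕtoℚ m ≤ mean n + ℕtoℚ d
    m≤mean+d = +-cancelʳ-≤ 1ℚ (begin
      ℕtoℚ m + 1ℚ                         ≡⟨ ℕtoℚ-+ m 1 ⟨
      ℕtoℚ (m ℕ.+ 1)                      ≤⟨ ℕtoℚ-mono-≤ (near-mode-below {m} {h} (ℕ.≰⇒> (¬far ∘ inj₂))) ⟩
      ℕtoℚ (mode ∸ (h ℕ.+ h) ℕ.+ d)       ≡⟨ ℕtoℚ-+ (mode ∸ (h ℕ.+ h)) d ⟩
      ℕtoℚ (mode ∸ (h ℕ.+ h)) + ℕtoℚ d    ≤⟨ +-monoˡ-≤ (ℕtoℚ d) mode∸2h≤mean+1 ⟩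
      mean n + 1ℚ + ℕtoℚ d                ≡⟨ swap (mean n) 1ℚ (ℕtoℚ d) ⟩
      mean n + ℕtoℚ d + 1ℚ                ∎)
      where
      open ≤-Reasoning
      swap : ∀ x y z → x + y + z ≡ x + z + y
      swap = solve-∀ ring
    mean≤m+d : mean n ≤ ℕtoℚ m + ℕtoℚ d
    mean≤m+d = begin
      mean n                              ≤⟨ mean≤c+1 ⟩
      ℕtoℚ c + 1ℚ                         ≡⟨ ℕtoℚ-+ c 1 ⟨
      ℕtoℚ (c ℕ.+ 1)                      ≤⟨ ℕtoℚ-mono-≤ (near-mode-above {m} {h} (ℕ.≰⇒> (¬far ∘ inj₁))) ⟩
      ℕtoℚ (m ℕ.+ d)                      ≡⟨ ℕtoℚ-+ m d ⟩
      ℕtoℚ m + ℕtoℚ d                     ∎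
      where open ≤-Reasoning

  outside⇒far : ∀ {m} → d ℕ.^ 4 ℕ.≤ n ℕ.^ 3 → ℕtoℚ (n ℕ.^ 3) < (ℕtoℚ m - mean n) ^ℚ 4 → Far m
  outside⇒far {m} d⁴≤n³ outside with Far? m
  ... | yes far = far
  ... | no ¬far = contradiction (<-≤-trans outside (begin
    (ℕtoℚ m - mean n) ^ℚ 4    ≤⟨ near⇒close ¬far ⟩
    ℕtoℚ d ^ℚ 4               ≡⟨ ℕtoℚ-^ d 4 ⟨
    ℕtoℚ (d ℕ.^ 4)            ≤⟨ ℕtoℚ-mono-≤ d⁴≤n³ ⟩
    ℕtoℚ (n ℕ.^ 3)            ∎)) (<-irrefl refl)
    where open ≤-Reasoning

  outsidePartial≤farSum : d ℕ.^ 4 ℕ.≤ n ℕ.^ 3 → ∀ L → outsidePartial n L ≤ farSum L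
  outsidePartial≤farSum d⁴≤n³ zero    = ≤-refl
  outsidePartial≤farSum d⁴≤n³ (suc L) = step (ℕtoℚ (n ℕ.^ 3) <? (ℕtoℚ L - mean n) ^ℚ 4)
    where
    IH : outsidePartial n L ≤ farSum L
    IH = outsidePartial≤farSum d⁴≤n³ L
    -- The decision is abstracted by hand: the normalised goal no longer mentions it, so `with` fails.
    step : (outside? : Dec (ℕtoℚ (n ℕ.^ 3) < (ℕtoℚ L - mean n) ^ℚ 4)) →
           (if does outside? then outsidePartial n L + w L else outsidePartial n L) ≤ farSum L + farWeight L
    step (yes outside) = +-mono-≤ IH (≤-trans (w≤v L) (≤-reflexive (sym (farWeight-far (outside⇒far {L} d⁴≤n³ outside)))))
    step (no  _)       = ≤-+ʳ-nonNeg (farWeight L) (farWeight-nonNeg L) IH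

  outsidePartial-bound : d ℕ.^ 4 ℕ.≤ n ℕ.^ 3 → ∀ {k q} → n ℕ.^ k ℕ.* q ℕ.≤ Z → ∀ L →
    ℕtoℚ (n ℕ.^ k) * outsidePartial n L * ℕtoℚ q ≤ B
  outsidePartial-bound d⁴≤n³ {k} {q} nᵏq≤Z L = begin
    ℕtoℚ (n ℕ.^ k) * outsidePartial n L * ℕtoℚ q ≤⟨ *-monoʳ-≤-nonNeg′ (ℕtoℚ q) (ℕtoℚ-nonNeg q)
                                                      (*-monoˡ-≤-nonNeg′ (ℕtoℚ (n ℕ.^ k)) (ℕtoℚ-nonNeg (n ℕ.^ k)) op≤far) ⟩
    ℕtoℚ (n ℕ.^ k) * farSum L * ℕtoℚ q           ≡⟨ xy∙z≈y∙xz (ℕtoℚ (n ℕ.^ k)) (farSum L) (ℕtoℚ q) ⟩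
    farSum L * (ℕtoℚ (n ℕ.^ k) * ℕtoℚ q)         ≡⟨ cong (farSum L *_) (ℕtoℚ-* (n ℕ.^ k) q) ⟨
    farSum L * ℕtoℚ (n ℕ.^ k ℕ.* q)              ≤⟨ *-monoˡ-≤-nonNeg′ (farSum L) (farSum-nonNeg L) (ℕtoℚ-mono-≤ nᵏq≤Z) ⟩
    farSum L * ℕtoℚ Z                           ≤⟨ farSum*Z≤bell L ⟩
    B                                           ∎
    where
    open ≤-Reasoning
    op≤far : outsidePartial n L ≤ farSum L
    op≤far = outsidePartial≤farSum d⁴≤n³ L

module ParameterChoice (k q : ℕ) .{{_ : ℕ.NonZero q}} where

  open import Data.Nat.Base
  open import Data.Nat.Properties
  open import Data.Nat.Tactic.RingSolver using (solve-∀)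
  open import Data.Product.Base using (∃-syntax; _×_; proj₁; proj₂)
  open import Relation.Nullary using (¬_)
  open import Relation.Nullary.Decidable using (¬?; decidable-stable)
  open import Algebra.Properties.CommutativeSemigroup *-commutativeSemigroup using (xy∙z≈xz∙y)
  open Naturals

  -- h = s · j with s maximal such that (4h + 1)⁴ ≤ n³, so h ≈ n^{3/4}.  The choice i = k + 4 makes
  -- n^{3i} = n · nᵏ · n³ · n^{2i}, so that N₀ ≤ n absorbs every constant when X · Dʲ is compared
  -- with s^{4i} ≤ (s · h)ʲ; Bernoulli's inequality then raises this to X · Dʰ ≤ (D + h)ʰ.
  i j : ℕ
  i = k + 4
  j = 2 * i

  1≤i : 1 ≤ i
  1≤i = ≤-trans (s≤s z≤n) (m≤n+m 4 k)

  1≤j : 1 ≤ j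
  1≤j = ≤-trans 1≤i (m≤m+n i (i + 0))

  instance
    j-nonZero : NonZero j
    j-nonZero = >-nonZero 1≤j

  N₀ : ℕ
  N₀ = (9 * j) ^ (4 * i) * (1638 * q) * 9 ^ i

  [9j]^[4i]≤N₀ : (9 * j) ^ (4 * i) ≤ N₀
  [9j]^[4i]≤N₀ = ≤-trans (m≤m*n _ (1638 * q) {{m*n≢0 1638 q}}) (m≤m*n _ (9 ^ i) {{m^n≢0 9 i}})

  record Parameters (n : ℕ) : Set where
    field
      h Z        : ℕ
      h≤n        : h ≤ n
      [4h+1]⁴≤n³ : (4 * h + 1) ^ 4 ≤ n ^ 3
      gain       : (4 * suc (2 * n) + 2) * suc (4 * suc (2 * n)) * suc (2 * n) ^ h * Z ≤ (suc (2 * n) + h) ^ h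
      Z-large    : 2 * suc (2 * n) ≤ Z
      n^k*q≤Z    : n ^ k * q ≤ Z

  module _ {n : ℕ} (N₀≤n : N₀ ≤ n) where

    1≤n : 1 ≤ n
    1≤n = ≤-trans (m^n>0 (9 * j) {{m*n≢0 9 j}} (4 * i)) (≤-trans [9j]^[4i]≤N₀ N₀≤n)

    instance
      n-nonZero : NonZero n
      n-nonZero = >-nonZero 1≤n

      nᵏ-nonZero : NonZero (n ^ k)
      nᵏ-nonZero = m^n≢0 n k

    Admissible : ℕ → Set
    Admissible s = (4 * (s * j) + 1) ^ 4 ≤ n ^ 3

    admissible-1 : Admissible 1
    admissible-1 = begin
      (4 * (1 * j) + 1) ^ 4   ≤⟨ ^-monoˡ-≤ 4 4j+1≤9j ⟩
      (9 * j) ^ 4             ≤⟨ ^-monoʳ-≤ (9 * j) {{m*n≢0 9 j}} (*-monoʳ-≤ 4 1≤i) ⟩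
      (9 * j) ^ (4 * i)       ≤⟨ [9j]^[4i]≤N₀ ⟩
      N₀                      ≤⟨ N₀≤n ⟩
      n                       ≤⟨ m≤m*n n (n ^ 2) {{m^n≢0 n 2}} ⟩
      n ^ 3                   ∎
      where
      open ≤-Reasoning
      4j+1≤9j : 4 * (1 * j) + 1 ≤ 9 * j
      4j+1≤9j = ≤-trans (+-monoʳ-≤ (4 * (1 * j)) (≤-trans 1≤j (m≤m*n j 5))) (≤-reflexive (4j+j*5≡9j j))
        where
        4j+j*5≡9j : ∀ j → 4 * (1 * j) + j * 5 ≡ 9 * j
        4j+j*5≡9j = solve-∀

    inadmissible-1+n : ¬ Admissible (suc n)
    inadmissible-1+n adm = <-irrefl refl (<-≤-trans (m<n⇒m³<n⁴ n<4[[1+n]j]+1) adm)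
      where
      n<4[[1+n]j]+1 : n < 4 * (suc n * j) + 1
      n<4[[1+n]j]+1 = ≤-trans (m≤m*n (suc n) j) (≤-trans (m≤m+n (suc n * j) _) (m≤m+n _ 1))

    private
      last-admissible : ∃[ a ] (a < n × ¬ ¬ Admissible (suc a) × ¬ Admissible (suc (suc a)))
      last-admissible = crossing {P = λ u → ¬ Admissible (suc u)} (λ u → ¬? (_ ≤? _))
                                 (λ ¬adm → ¬adm admissible-1) {n} inadmissible-1+n

    opaque
      a : ℕ
      a = proj₁ last-admissible

      admissible-1+a : Admissible (suc a)
      admissible-1+a = decidable-stable (_ ≤? _) (proj₁ (proj₂ (proj₂ last-admissible)))

      inadmissible-2+a : ¬ Admissible (suc (suc a))
      inadmissible-2+a = proj₂ (proj₂ (proj₂ last-admissible))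

    s h : ℕ
    s = suc a
    h = s * j

    4h+1≤n : 4 * h + 1 ≤ n
    4h+1≤n = ≮⇒≥ (λ n<4h+1 → <-irrefl refl (<-≤-trans (m<n⇒m³<n⁴ n<4h+1) admissible-1+a))

    h≤n : h ≤ n
    h≤n = ≤-trans (m≤n*m h 4) (≤-trans (m≤m+n (4 * h) 1) 4h+1≤n)

    n³≤[9j]⁴*s⁴ : n ^ 3 ≤ (9 * j) ^ 4 * s ^ 4
    n³≤[9j]⁴*s⁴ = ≤-trans (<⇒≤ (≰⇒> inadmissible-2+a)) (≤-trans (^-monoˡ-≤ 4 4[[1+s]j]+1≤9js) (≤-reflexive (^-distribʳ-* (9 * j) s 4)))
      where
      open ≤-Reasoning
      expand : ∀ s j → 4 * ((1 + s) * j) + 1 ≡ 4 * s * j + (4 * j + 1)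
      expand = solve-∀
      collect : ∀ s j → 4 * s * j + 5 * s * j ≡ 9 * j * s
      collect = solve-∀
      4j+j≡5j : ∀ j → 4 * j + j ≡ 5 * j
      4j+j≡5j = solve-∀
      4j+1≤5sj : 4 * j + 1 ≤ 5 * s * j
      4j+1≤5sj = begin
        4 * j + 1       ≤⟨ +-monoʳ-≤ (4 * j) 1≤j ⟩
        4 * j + j       ≡⟨ 4j+j≡5j j ⟩
        5 * j           ≤⟨ *-monoˡ-≤ j (*-monoʳ-≤ 5 (s≤s (z≤n {a}))) ⟩
        5 * s * j       ∎
      4[[1+s]j]+1≤9js : 4 * (suc s * j) + 1 ≤ 9 * j * s
      4[[1+s]j]+1≤9js = begin
        4 * (suc s * j) + 1         ≡⟨ expand s j ⟩
        4 * s * j + (4 * j + 1)     ≤⟨ +-monoʳ-≤ (4 * s * j) 4j+1≤5sj ⟩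
        4 * s * j + 5 * s * j       ≡⟨ collect s j ⟩
        9 * j * s                   ∎

    n^[3i]≤[9j]^[4i]*s^[4i] : n ^ (3 * i) ≤ (9 * j) ^ (4 * i) * s ^ (4 * i)
    n^[3i]≤[9j]^[4i]*s^[4i] = begin
      n ^ (3 * i)                         ≡⟨ ^-*-assoc n 3 i ⟨
      (n ^ 3) ^ i                         ≤⟨ ^-monoˡ-≤ i n³≤[9j]⁴*s⁴ ⟩
      ((9 * j) ^ 4 * s ^ 4) ^ i           ≡⟨ ^-distribʳ-* ((9 * j) ^ 4) (s ^ 4) i ⟩
      ((9 * j) ^ 4) ^ i * (s ^ 4) ^ i     ≡⟨ cong₂ _*_ (^-*-assoc (9 * j) 4 i) (^-*-assoc s 4 i) ⟩
      (9 * j) ^ (4 * i) * s ^ (4 * i)     ∎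
      where open ≤-Reasoning

    D T Z X : ℕ
    D = suc (2 * n)
    T = 4 * D
    Z = n ^ k * q + 4 * suc n
    X = (T + 2) * suc T * Z

    T+2≤14n : T + 2 ≤ 14 * n
    T+2≤14n = subst (_≤ 14 * n) (8n+6≡T+2 n) (a*n+b≤[a+b]*n 8 6 n)
      where
      8n+6≡T+2 : ∀ n → 8 * n + 6 ≡ 4 * suc (2 * n) + 2
      8n+6≡T+2 = solve-∀

    1+T≤13n : suc T ≤ 13 * n
    1+T≤13n = subst (_≤ 13 * n) (8n+5≡1+T n) (a*n+b≤[a+b]*n 8 5 n)
      where
      8n+5≡1+T : ∀ n → 8 * n + 5 ≡ suc (4 * suc (2 * n))
      8n+5≡1+T = solve-∀

    Z≤9qnᵏn : Z ≤ 9 * q * n ^ k * n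
    Z≤9qnᵏn = begin
      n ^ k * q + 4 * suc n                ≤⟨ +-mono-≤ nᵏq≤qnᵏn (≤-trans 4[1+n]≤8n (*-monoʳ-≤ 8 n≤qnᵏn)) ⟩
      q * n ^ k * n + 8 * (q * n ^ k * n)  ≡⟨ x+8x≡9x q (n ^ k) n ⟩
      9 * q * n ^ k * n                    ∎
      where
      open ≤-Reasoning
      x+8x≡9x : ∀ q y n → q * y * n + 8 * (q * y * n) ≡ 9 * q * y * n
      x+8x≡9x = solve-∀
      4n+4≡4[1+n] : ∀ n → 4 * n + 4 ≡ 4 * suc n
      4n+4≡4[1+n] = solve-∀
      4[1+n]≤8n : 4 * suc n ≤ 8 * n
      4[1+n]≤8n = subst (_≤ 8 * n) (4n+4≡4[1+n] n) (a*n+b≤[a+b]*n 4 4 n)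
      nᵏq≤qnᵏn : n ^ k * q ≤ q * n ^ k * n
      nᵏq≤qnᵏn = ≤-trans (≤-reflexive (*-comm (n ^ k) q)) (m≤m*n (q * n ^ k) n)
      n≤qnᵏn : n ≤ q * n ^ k * n
      n≤qnᵏn = m≤n*m n (q * n ^ k) {{m*n≢0 q (n ^ k)}}

    X≤1638qnᵏn³ : X ≤ 1638 * q * n ^ k * n ^ 3
    X≤1638qnᵏn³ = begin
      (T + 2) * suc T * Z                      ≤⟨ *-mono-≤ (*-mono-≤ T+2≤14n 1+T≤13n) Z≤9qnᵏn ⟩
      14 * n * (13 * n) * (9 * q * n ^ k * n)  ≡⟨ collect n q (n ^ k) ⟩
      1638 * q * n ^ k * n ^ 3                 ∎
      where
      open ≤-Reasoning
      collect : ∀ n q y → 14 * n * (13 * n) * (9 * q * y * n) ≡ 1638 * q * y * (n * (n * (n * 1)))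
      collect = solve-∀

    D^[2i]≤9^i*n^[2i] : D ^ (2 * i) ≤ 9 ^ i * n ^ (2 * i)
    D^[2i]≤9^i*n^[2i] = begin
      D ^ (2 * i)                   ≤⟨ ^-monoˡ-≤ (2 * i) D≤3n ⟩
      (3 * n) ^ (2 * i)             ≡⟨ ^-distribʳ-* 3 n (2 * i) ⟩
      3 ^ (2 * i) * n ^ (2 * i)     ≡⟨ cong (_* n ^ (2 * i)) (^-*-assoc 3 2 i) ⟨
      9 ^ i * n ^ (2 * i)           ∎
      where
      open ≤-Reasoning
      2n+n≡3n : ∀ n → 2 * n + n ≡ 3 * n
      2n+n≡3n = solve-∀
      D≤3n : D ≤ 3 * n
      D≤3n = ≤-trans (≤-reflexive (+-comm 1 (2 * n))) (≤-trans (+-monoʳ-≤ (2 * n) 1≤n) (≤-reflexive (2n+n≡3n n)))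

    n^[3i]≡n*[nᵏn³n^[2i]] : n ^ (3 * i) ≡ n * (n ^ k * n ^ 3 * n ^ (2 * i))
    n^[3i]≡n*[nᵏn³n^[2i]] = begin
      n ^ (3 * i)                        ≡⟨ cong (n ^_) (3[k+4]≡1+[k+3+2[k+4]] k) ⟩
      n * n ^ (k + 3 + 2 * i)            ≡⟨ cong (n *_) (^-distribˡ-+-* n (k + 3) (2 * i)) ⟩
      n * (n ^ (k + 3) * n ^ (2 * i))    ≡⟨ cong (λ x → n * (x * n ^ (2 * i))) (^-distribˡ-+-* n k 3) ⟩
      n * (n ^ k * n ^ 3 * n ^ (2 * i))  ∎
      where
      open ≡-Reasoning
      3[k+4]≡1+[k+3+2[k+4]] : ∀ k → 3 * (k + 4) ≡ 1 + (k + 3 + 2 * (k + 4))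
      3[k+4]≡1+[k+3+2[k+4]] = solve-∀

    X*Dʲ≤s^[4i] : X * D ^ j ≤ s ^ (4 * i)
    X*Dʲ≤s^[4i] = *-cancelˡ-≤ ((9 * j) ^ (4 * i)) {{m^n≢0 (9 * j) (4 * i) {{m*n≢0 9 j}}}} (begin
      (9 * j) ^ (4 * i) * (X * D ^ j)
        ≤⟨ *-monoʳ-≤ ((9 * j) ^ (4 * i)) (*-mono-≤ X≤1638qnᵏn³ D^[2i]≤9^i*n^[2i]) ⟩
      (9 * j) ^ (4 * i) * (1638 * q * n ^ k * n ^ 3 * (9 ^ i * n ^ (2 * i)))
        ≡⟨ regroup ((9 * j) ^ (4 * i)) q (n ^ k) (n ^ 3) (9 ^ i) (n ^ (2 * i)) ⟩
      N₀ * (n ^ k * n ^ 3 * n ^ (2 * i))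
        ≤⟨ *-monoˡ-≤ (n ^ k * n ^ 3 * n ^ (2 * i)) N₀≤n ⟩
      n * (n ^ k * n ^ 3 * n ^ (2 * i))
        ≡⟨ n^[3i]≡n*[nᵏn³n^[2i]] ⟨
      n ^ (3 * i)
        ≤⟨ n^[3i]≤[9j]^[4i]*s^[4i] ⟩
      (9 * j) ^ (4 * i) * s ^ (4 * i) ∎)
      where
      open ≤-Reasoning
      regroup : ∀ a q y c g d → a * (1638 * q * y * c * (g * d)) ≡ a * (1638 * q) * g * (y * c * d)
      regroup = solve-∀

    X*Dʲ≤[s*h]ʲ : X * D ^ j ≤ (s * h) ^ j
    X*Dʲ≤[s*h]ʲ = begin
      X * D ^ j          ≤⟨ X*Dʲ≤s^[4i] ⟩
      s ^ (4 * i)        ≡⟨ cong (s ^_) (4i≡2i+2i i) ⟩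
      s ^ (j + j)        ≡⟨ ^-distribˡ-+-* s j j ⟩
      s ^ j * s ^ j      ≡⟨ ^-distribʳ-* s s j ⟨
      (s * s) ^ j        ≤⟨ ^-monoˡ-≤ j (*-monoʳ-≤ s (m≤m*n s j)) ⟩
      (s * h) ^ j        ∎
      where
      open ≤-Reasoning
      4i≡2i+2i : ∀ i → 4 * i ≡ 2 * i + 2 * i
      4i≡2i+2i = solve-∀

    parameters : Parameters n
    parameters = record
      { h          = h
      ; Z          = Z
      ; h≤n        = h≤n
      ; [4h+1]⁴≤n³ = admissible-1+a
      ; gain       = ≤-trans (≤-reflexive (xy∙z≈xz∙y ((T + 2) * suc T) (D ^ h) Z)) (bernoulli-power a j X D X*Dʲ≤[s*h]ʲ)
      ; Z-large    = ≤-trans (*-monoʳ-≤ 2 (n≤1+n D)) (≤-trans (≤-reflexive (2[2+2n]≡4[1+n] n)) (m≤n+m (4 * suc n) (n ^ k * q)))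
      ; n^k*q≤Z    = m≤m+n (n ^ k * q) (4 * suc n)
      }
      where
      2[2+2n]≡4[1+n] : ∀ n → 2 * suc (suc (2 * n)) ≡ 4 * suc n
      2[2+2n]≡4[1+n] = solve-∀

open import Data.Nat.Base using (_^_; _≤_)
open import Data.Rational.Base using (ℚ; _<_; 0ℚ) renaming (_*_ to _*ℚ_; _≤_ to _≤ℚ_)
open import Data.Product.Base using (∃-syntax; _,_)
open Rationals using (archimedean; ≤-*-from-reciprocal; ℕtoℚ-pos; ℕtoℚ-nonNeg)

lemma5p5 : ∀ (k : ℕ) (ε : ℚ) → 0ℚ < ε →
    ∃[ N ] (∀ (n : ℕ) → N ≤ n → ∀ (L : ℕ) →
      ℕtoℚ (n ^ k) *ℚ outsidePartial n L ≤ℚ ε *ℚ ℕtoℚ (bell n))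
lemma5p5 k ε 0<ε with archimedean ε 0<ε
... | q , 1≤ε[1+q] = N₀ , bound
  where
  open ParameterChoice k (ℕ.suc q) using (N₀; module Parameters; parameters; n-nonZero)
  bound : ∀ n → N₀ ≤ n → ∀ L → ℕtoℚ (n ^ k) *ℚ outsidePartial n L ≤ℚ ε *ℚ ℕtoℚ (bell n)
  bound n N₀≤n L = ≤-*-from-reciprocal {ε = ε} (ℕtoℚ-pos (ℕ.suc q)) (ℕtoℚ-nonNeg (bell n)) 1≤ε[1+q]
    (Concentration.outsidePartial-bound n h Z h≤n gain Z-large [4h+1]⁴≤n³ {k} {ℕ.suc q} n^k*q≤Z L)
    where
    open Parameters (parameters N₀≤n)
    instance
      n≢0 : ℕ.NonZero n
      n≢0 = n-nonZero N₀≤n
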